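{- Let $a,b$ be indeterminates and $\phi_{a,b}(x,y)=[x^2+axy:bxy+y^2]$. For every integer $N>1$, the coefficient of $x^{\nu_2(N)}$ in $\Phi^*_{N,\phi_{a,b}}(x,y)$ (its leading coefficient as a polynomial in $x$) is $C_N(b)$, the $N$-th cyclotomic polynomial evaluated at $b$; and the coefficient of $y^{\nu_2(N)}$ is $C_N(a)$.
   Context: For $\phi=[F_1:G_1]$, iterates are $F_N=F_{N-1}(F_1,G_1)$, $G_N=G_{N-1}(F_1,G_1)$; $\Phi_{N,\phi}=yF_N-xG_N$ and $\Phi^*_{N,\phi}=\prod_{k\mid N}\Phi_{k,\phi}^{\mu(N/k)}$ ($\mu$ the Möbius function), a homogeneous polynomial in $x,y$ with coefficients in $\mathbb Z[a,b]$. $\nu_2(N)=\sum_{k\mid N}\mu(N/k)2^k$ is its degree for $N>1$. -}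

module Defs where

open import Data.Nat as ℕ using (ℕ; zero; suc; _∸_; _≤?_; _≡ᵇ_)
open import Data.Nat.Divisibility using (_∣?_)
open import Data.Nat.DivMod using (_/_)
open import Data.Nat.Primality using (prime?)
open import Data.Integer as ℤ using (ℤ; +_; -[1+_])
open import Data.Integer.Properties using () renaming (_≟_ to _≟ℤ_)
open import Data.List using (List; []; _∷_; filter; upTo; length; foldr; map)
open import Data.Bool.ListAction using (any)
open import Data.Bool using (Bool; true; false; if_then_else_; _∧_)
open import Data.Product using (_×_; _,_; proj₁; proj₂)
open import Relation.Nullary.Decidable using (_×-dec_; does)
open import Relation.Binary.PropositionalEquality using (_≡_)

-- A series P is its coefficient function: P i j k l is the coefficient
-- of x^i y^j a^k b^l.  Polynomials embed (finite support);
-- ℤ[[x,y,a,b]] is an integral domain, so exact quotients are unique.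

Series : Set
Series = ℕ → ℕ → ℕ → ℕ → ℤ

Σ≤ : ℕ → (ℕ → ℤ) → ℤ
Σ≤ zero    f = f 0
Σ≤ (suc n) f = Σ≤ n f ℤ.+ f (suc n)

_⊕_ : Series → Series → Series
(p ⊕ q) i j k l = p i j k l ℤ.+ q i j k l

⊖_ : Series → Series
(⊖ p) i j k l = ℤ.- p i j k l

_⊛_ : Series → Series → Series
(p ⊛ q) i j k l =
  Σ≤ i λ i₁ → Σ≤ j λ j₁ → Σ≤ k λ k₁ → Σ≤ l λ l₁ →
    p i₁ j₁ k₁ l₁ ℤ.* q (i ∸ i₁) (j ∸ j₁) (k ∸ k₁) (l ∸ l₁)

b2z : Bool → ℤ
b2z true  = + 1
b2z false = + 0

mono : ℤ → ℕ → ℕ → ℕ → ℕ → Series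
mono c e₁ e₂ e₃ e₄ i j k l =
  if (i ≡ᵇ e₁) ∧ (j ≡ᵇ e₂) ∧ (k ≡ᵇ e₃) ∧ (l ≡ᵇ e₄) then c else + 0

data Var : Set where
  vx vy va vb : Var

infixl 6 _:+_ _:-_
infixl 7 _:*_

data Expr : Set where
  var  : Var → Expr
  con  : ℤ → Expr
  _:+_ : Expr → Expr → Expr
  _:*_ : Expr → Expr → Expr
  :-_  : Expr → Expr

_:-_ : Expr → Expr → Expr
e :- f = e :+ (:- f)

X Y A B : Expr
X = var vx
Y = var vy
A = var va
B = var vb

_:^_ : Expr → ℕ → Expr
e :^ zero  = con (+ 1)
e :^ suc n = (e :^ n) :* e

⟦_⟧ : Expr → Series
⟦ var vx ⟧ = mono (+ 1) 1 0 0 0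
⟦ var vy ⟧ = mono (+ 1) 0 1 0 0
⟦ var va ⟧ = mono (+ 1) 0 0 1 0
⟦ var vb ⟧ = mono (+ 1) 0 0 0 1
⟦ con c ⟧  = mono c 0 0 0 0
⟦ e :+ f ⟧ = ⟦ e ⟧ ⊕ ⟦ f ⟧
⟦ e :* f ⟧ = ⟦ e ⟧ ⊛ ⟦ f ⟧
⟦ :- e ⟧   = ⊖ ⟦ e ⟧

substXY : Expr → Expr → Expr → Expr
substXY F G (var vx) = F
substXY F G (var vy) = G
substXY F G (var va) = A
substXY F G (var vb) = B
substXY F G (con c)  = con c
substXY F G (e :+ f) = substXY F G e :+ substXY F G f
substXY F G (e :* f) = substXY F G e :* substXY F G f
substXY F G (:- e)   = :- substXY F G e

F₁ G₁ : Expr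
F₁ = X :* X :+ A :* X :* Y
G₁ = B :* X :* Y :+ Y :* Y

iter : ℕ → Expr × Expr
iter zero    = X , Y
iter (suc n) = substXY F₁ G₁ (proj₁ (iter n)) , substXY F₁ G₁ (proj₂ (iter n))

Φ : ℕ → Expr
Φ N = Y :* proj₁ (iter N) :- X :* proj₂ (iter N)

primeDivisors : ℕ → List ℕ
primeDivisors n = filter (λ p → prime? p ×-dec p ∣? n) (upTo (suc n))

hasSquareFactor : ℕ → Bool
hasSquareFactor n = any (λ p → does (2 ≤? p) ∧ does ((p ℕ.* p) ∣? n)) (upTo (suc n))

μ : ℕ → ℤ
μ zero = + 0
μ (suc n) = if hasSquareFactor (suc n) then + 0
            else (ℤ.- (+ 1)) ℤ.^ length (primeDivisors (suc n))

divisors : ℕ → List ℕ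
divisors N = filter (λ d → 1 ≤? d ×-dec d ∣? N) (upTo (suc N))

quot : ℕ → ℕ → ℕ
quot N zero    = 0
quot N (suc d) = N / suc d

prodE : List Expr → Expr
prodE = foldr _:*_ (con (+ 1))

-- numerator / denominator of ∏_{k ∣ N} f(k)^{μ(N/k)}
mobNum mobDen : (ℕ → Expr) → ℕ → Expr
mobNum f N = prodE (map f (filter (λ k → μ (quot N k) ≟ℤ + 1) (divisors N)))
mobDen f N = prodE (map f (filter (λ k → μ (quot N k) ≟ℤ ℤ.- (+ 1)) (divisors N)))

IsQuotient : Expr → Expr → Series → Set
IsQuotient num den P = ∀ i j k l → (P ⊛ ⟦ den ⟧) i j k l ≡ ⟦ num ⟧ i j k l

-- P = Φ*_{N,φ_{a,b}} = ∏_{k∣N} Φ_{k,φ}^{μ(N/k)}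
IsPhiStar : ℕ → Series → Set
IsPhiStar N P = IsQuotient (mobNum Φ N) (mobDen Φ N) P

-- C = C_N(v), the N-th cyclotomic polynomial in the variable v,
-- via C_N(v) = ∏_{d∣N} (v^d − 1)^{μ(N/d)}
IsCyclotomic : Var → ℕ → Series → Set
IsCyclotomic v N C =
  IsQuotient (mobNum (λ d → var v :^ d :- con (+ 1)) N)
             (mobDen (λ d → var v :^ d :- con (+ 1)) N) C

ν₂ : ℕ → ℤ
ν₂ N = foldr (λ k s → μ (quot N k) ℤ.* (+ (2 ℕ.^ k)) ℤ.+ s) (+ 0) (divisors N)

-- By induction on k, F_k ≡ x^(2^k) and G_k ≡ bᵏ x^(2^k−1) y modulo y², so
-- Φ_k ≡ (1 − bᵏ) x^(2^k) y modulo y², and symmetrically Φ_k ≡ (aᵏ − 1) y^(2^k) x modulo x².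
-- Φ*_N = ∏⁺ Φ_k / ∏⁻ Φ_k, the products running over the divisors k of N with μ(N/k) = 1 and μ(N/k) = −1,
-- and since Σ_{d∣N} μ(d) = 0 for N > 1 both products have the same number m of factors. Comparing
-- leading terms in y, the identity P · ∏⁻ Φ_k = ∏⁺ Φ_k forces ν₂(N) = Σ⁺ 2ᵏ − Σ⁻ 2ᵏ ≥ 0 and, for the
-- coefficient Q of x^ν₂(N) y⁰ in P, Q · ∏⁻ (1 − bᵏ) = ∏⁺ (1 − bᵏ) in ℤ[[a,b]]. Up to the common sign
-- (−1)ᵐ this is the equation defining C_N(b), and the denominator has constant term ±1, so Q = C_N(b).
-- Leading terms in x give C_N(a) in the same way.

module Submission where

open import Defs
open import Data.Bool using (true; false; if_then_else_; _∧_; T)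
import Data.Bool.Properties as Bool
open import Data.Integer as ℤ using (ℤ; +_; 0ℤ; 1ℤ; -1ℤ; ∣_∣)
import Data.Integer.Properties as ℤ
open import Data.List using (List; []; _∷_; length; map; foldr; filter; applyUpTo; upTo)
open import Data.List.Membership.Propositional using (lose)
open import Data.List.Membership.Propositional.Properties using (∈-upTo⁺)
open import Data.List.Relation.Unary.All using (All; []; _∷_)
import Data.List.Relation.Unary.All as All
import Data.List.Relation.Unary.All.Properties as All
open import Data.List.Relation.Unary.Any using (satisfied)
open import Data.List.Relation.Unary.Any.Properties using (any⁺; any⁻)
open import Data.Nat as ℕ using (ℕ; zero; suc; _+_; _*_; _∸_; _^_; _≤_; _<_; z≤n; s≤s; z<s; s<s; _≡ᵇ_)
import Data.Nat.Properties as ℕ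
open import Data.Nat.Coprimality using (Coprime; coprime-divisor)
open import Data.Nat.Divisibility
  using (_∣_; divides; _∣?_; ∣-refl; ∣-trans; *-pres-∣; ∣⇒≤; m∣m*n; n∣m*n; *-monoˡ-∣; *-cancelʳ-∣; ∣m+n∣m⇒∣n)
open import Data.Nat.DivMod using (m*n/n≡m)
open import Data.Nat.Induction using (<-rec)
open import Data.Nat.ListAction using (sum; product)
open import Data.Nat.Primality
  using (Prime; prime?; euclidsLemma; prime⇒irreducible; prime⇒nonZero; prime⇒nonTrivial)
open import Data.Nat.Primality.Factorisation using (factorise)
open import Data.Product using (_×_; _,_; proj₁; proj₂; ∃)
open import Data.Sum using (_⊎_; inj₁; inj₂)
open import Function using (_∘_; id)
open import Function.Bundles using (Equivalence)
open import Relation.Binary.PropositionalEquality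
open import Relation.Nullary using (¬_; Dec; yes; no; does; contradiction)
open import Relation.Nullary.Decidable using (dec-true; dec-false; _×-dec_; T?)
open import Relation.Unary using (Decidable)
open import Algebra.Properties.AbelianGroup ℤ.+-0-abelianGroup
  using () renaming (∙-cancelˡ to +-cancelˡ; ∙-cancelʳ to +-cancelʳ; ⁻¹-anti-homo‿- to -[i-j]≡j-i)
open import Algebra.Properties.CommutativeSemigroup ℕ.*-commutativeSemigroup
  using () renaming (xy∙z≈xz∙y to *-rightComm)
open import Algebra.Properties.CommutativeSemigroup ℤ.+-commutativeSemigroup
  using () renaming (interchange to +-interchange; x∙yz≈y∙xz to +-leftComm)

-- Finite sums

Σ≤-cong : ∀ n {f g : ℕ → ℤ} → (∀ t → t ≤ n → f t ≡ g t) → Σ≤ n f ≡ Σ≤ n g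
Σ≤-cong zero    f≡g = f≡g 0 z≤n
Σ≤-cong (suc n) f≡g =
  cong₂ ℤ._+_ (Σ≤-cong n λ t t≤n → f≡g t (ℕ.m≤n⇒m≤1+n t≤n)) (f≡g (suc n) ℕ.≤-refl)

Σ≤-zero : ∀ n {f : ℕ → ℤ} → (∀ t → t ≤ n → f t ≡ 0ℤ) → Σ≤ n f ≡ 0ℤ
Σ≤-zero zero    f≡0 = f≡0 0 z≤n
Σ≤-zero (suc n) f≡0 =
  cong₂ ℤ._+_ (Σ≤-zero n λ t t≤n → f≡0 t (ℕ.m≤n⇒m≤1+n t≤n)) (f≡0 (suc n) ℕ.≤-refl)

Σ≤-single : ∀ n e {f : ℕ → ℤ} → e ≤ n → (∀ t → t ≤ n → t ≢ e → f t ≡ 0ℤ) → Σ≤ n f ≡ f e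
Σ≤-single zero    .zero z≤n _   = refl
Σ≤-single (suc n) e {f} e≤1+n f≡0 with e ℕ.≟ suc n
... | yes refl = trans (cong (ℤ._+ f (suc n)) (Σ≤-zero n λ t t≤n → f≡0 t (ℕ.m≤n⇒m≤1+n t≤n) (ℕ.<⇒≢ (s≤s t≤n))))
                       (ℤ.+-identityˡ (f (suc n)))
... | no e≢1+n = trans (cong₂ ℤ._+_ (Σ≤-single n e e≤n λ t t≤n → f≡0 t (ℕ.m≤n⇒m≤1+n t≤n))
                                    (f≡0 (suc n) ℕ.≤-refl (e≢1+n ∘ sym)))
                       (ℤ.+-identityʳ (f e))
  where
  e≤n : e ≤ n
  e≤n = ℕ.≤-pred (ℕ.≤∧≢⇒< e≤1+n e≢1+n)

Σ≤-neg : ∀ n (f : ℕ → ℤ) → Σ≤ n (λ t → ℤ.- f t) ≡ ℤ.- Σ≤ n f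
Σ≤-neg zero    f = refl
Σ≤-neg (suc n) f =
  trans (cong (ℤ._+ ℤ.- f (suc n)) (Σ≤-neg n f)) (sym (ℤ.neg-distrib-+ (Σ≤ n f) (f (suc n))))

Σ≤-cancel-last : ∀ n {f g : ℕ → ℤ} → (∀ t → t < n → f t ≡ g t) → Σ≤ n f ≡ Σ≤ n g → f n ≡ g n
Σ≤-cancel-last zero    _   Σf≡Σg = Σf≡Σg
Σ≤-cancel-last (suc n) {f} {g} f≡g Σf≡Σg = +-cancelˡ (Σ≤ n g) (f (suc n)) (g (suc n))
  (trans (cong (ℤ._+ f (suc n)) (sym (Σ≤-cong n λ t t≤n → f≡g t (s≤s t≤n)))) Σf≡Σg)

Σ< : ℕ → (ℕ → ℤ) → ℤ
Σ< zero    f = 0ℤ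
Σ< (suc n) f = f 0 ℤ.+ Σ< n (f ∘ suc)

Σ<-cong : ∀ n {f g : ℕ → ℤ} → (∀ t → t < n → f t ≡ g t) → Σ< n f ≡ Σ< n g
Σ<-cong zero    _   = refl
Σ<-cong (suc n) f≡g = cong₂ ℤ._+_ (f≡g 0 z<s) (Σ<-cong n λ t t<n → f≡g (suc t) (s<s t<n))

Σ<-zero : ∀ n {f : ℕ → ℤ} → (∀ t → t < n → f t ≡ 0ℤ) → Σ< n f ≡ 0ℤ
Σ<-zero zero    _   = refl
Σ<-zero (suc n) f≡0 = cong₂ ℤ._+_ (f≡0 0 z<s) (Σ<-zero n λ t t<n → f≡0 (suc t) (s<s t<n))

Σ<-+ : ∀ n (f g : ℕ → ℤ) → Σ< n (λ t → f t ℤ.+ g t) ≡ Σ< n f ℤ.+ Σ< n g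
Σ<-+ zero    f g = refl
Σ<-+ (suc n) f g = trans (cong (ℤ._+_ (f 0 ℤ.+ g 0)) (Σ<-+ n (f ∘ suc) (g ∘ suc)))
                         (+-interchange (f 0) (g 0) (Σ< n (f ∘ suc)) (Σ< n (g ∘ suc)))

Σ<-++ : ∀ m n (f : ℕ → ℤ) → Σ< (m + n) f ≡ Σ< m f ℤ.+ Σ< n (λ u → f (m + u))
Σ<-++ zero    n f = sym (ℤ.+-identityˡ _)
Σ<-++ (suc m) n f = trans (cong (ℤ._+_ (f 0)) (Σ<-++ m n (f ∘ suc))) (sym (ℤ.+-assoc (f 0) _ _))

Σ<-extend : ∀ {m n} (f : ℕ → ℤ) → m ≤ n → (∀ t → m ≤ t → f t ≡ 0ℤ) → Σ< n f ≡ Σ< m f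
Σ<-extend {m} {n} f m≤n f≡0 = begin
  Σ< n f                                   ≡⟨ cong (λ k → Σ< k f) (ℕ.m+[n∸m]≡n m≤n) ⟨
  Σ< (m + (n ∸ m)) f                       ≡⟨ Σ<-++ m (n ∸ m) f ⟩
  Σ< m f ℤ.+ Σ< (n ∸ m) (λ u → f (m + u))  ≡⟨ cong (ℤ._+_ (Σ< m f)) (Σ<-zero (n ∸ m) λ u _ →
                                                  f≡0 (m + u) (ℕ.m≤m+n m u)) ⟩
  Σ< m f ℤ.+ 0ℤ                            ≡⟨ ℤ.+-identityʳ _ ⟩
  Σ< m f                                   ∎
  where open ≡-Reasoning

Σ<-single : ∀ n e (f : ℕ → ℤ) → e < n → (∀ t → t < n → t ≢ e → f t ≡ 0ℤ) → Σ< n f ≡ f e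
Σ<-single (suc n) zero    f _ f≡0 =
  trans (cong (ℤ._+_ (f 0)) (Σ<-zero n λ t t<n → f≡0 (suc t) (s<s t<n) λ ())) (ℤ.+-identityʳ (f 0))
Σ<-single (suc n) (suc e) f (s<s e<n) f≡0 =
  trans (cong (ℤ._+ Σ< n (f ∘ suc)) (f≡0 0 z<s λ ()))
  (trans (ℤ.+-identityˡ _)
         (Σ<-single n e (f ∘ suc) e<n λ t t<n t≢e → f≡0 (suc t) (s<s t<n) (t≢e ∘ ℕ.suc-injective)))

Σ<-stride : ∀ p L (f : ℕ → ℤ) → .{{ℕ.NonZero p}} → (∀ t → ¬ p ∣ t → f t ≡ 0ℤ) →
  Σ< (L * p) f ≡ Σ< L (λ s → f (s * p))
Σ<-stride p zero    f f≡0 = refl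
Σ<-stride p (suc L) f f≡0 = begin
  Σ< (p + L * p) f                         ≡⟨ Σ<-++ p (L * p) f ⟩
  Σ< p f ℤ.+ Σ< (L * p) (λ u → f (p + u))  ≡⟨ cong₂ ℤ._+_ first-block
                                                  (Σ<-stride p L (λ u → f (p + u)) shifted-f≡0) ⟩
  f 0 ℤ.+ Σ< L (λ s → f (p + s * p))       ∎
  where
  open ≡-Reasoning
  first-block : Σ< p f ≡ f 0
  first-block = Σ<-single p 0 f (ℕ.>-nonZero⁻¹ p) λ t t<p t≢0 →
    f≡0 t λ p∣t → ℕ.<⇒≱ t<p (∣⇒≤ {{ℕ.≢-nonZero t≢0}} p∣t)
  shifted-f≡0 : ∀ u → ¬ p ∣ u → f (p + u) ≡ 0ℤ
  shifted-f≡0 u p∤u = f≡0 (p + u) λ p∣p+u → p∤u (∣m+n∣m⇒∣n p∣p+u ∣-refl)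

foldr-filter-applyUpTo : ∀ {P : ℕ → Set} (P? : Decidable P) (f : ℕ → ℤ) (h : ℕ → ℕ) n →
  foldr (λ k s → f k ℤ.+ s) 0ℤ (filter P? (applyUpTo h n)) ≡
  Σ< n (λ t → if does (P? (h t)) then f (h t) else 0ℤ)
foldr-filter-applyUpTo P? f h zero    = refl
foldr-filter-applyUpTo P? f h (suc n) with does (P? (h 0))
... | true  = cong (ℤ._+_ (f (h 0))) (foldr-filter-applyUpTo P? f (h ∘ suc) n)
... | false = trans (foldr-filter-applyUpTo P? f (h ∘ suc) n) (sym (ℤ.+-identityˡ _))

+length≡foldr : ∀ {A : Set} (xs : List A) → + length xs ≡ foldr (λ _ s → 1ℤ ℤ.+ s) 0ℤ xs
+length≡foldr []       = refl
+length≡foldr (x ∷ xs) = trans (ℤ.pos-+ 1 (length xs)) (cong (ℤ._+_ 1ℤ) (+length≡foldr xs))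

sum-map-const-1 : ∀ {A : Set} (xs : List A) → sum (map (λ _ → 1) xs) ≡ length xs
sum-map-const-1 []       = refl
sum-map-const-1 (x ∷ xs) = cong suc (sum-map-const-1 xs)

-- Power series in a and b

≡ᵇ-refl : ∀ m → (m ≡ᵇ m) ≡ true
≡ᵇ-refl m = dec-true (m ℕ.≟ m) refl

≢⇒≡ᵇ-false : ∀ {m n} → m ≢ n → (m ≡ᵇ n) ≡ false
≢⇒≡ᵇ-false {m} {n} = dec-false (m ℕ.≟ n)

Series₂ : Set
Series₂ = ℕ → ℕ → ℤ

infix  4 _≈₂_
infixl 6 _⊝₂_
infixl 7 _⊛₂_

_≈₂_ : Series₂ → Series₂ → Set
p ≈₂ q = ∀ k l → p k l ≡ q k l

0₂ : Series₂
0₂ k l = 0ℤ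

⊖₂_ : Series₂ → Series₂
(⊖₂ p) k l = ℤ.- p k l

_⊝₂_ : Series₂ → Series₂ → Series₂
(p ⊝₂ q) k l = p k l ℤ.- q k l

_⊛₂_ : Series₂ → Series₂ → Series₂
(p ⊛₂ q) k l = Σ≤ k λ k₁ → Σ≤ l λ l₁ → p k₁ l₁ ℤ.* q (k ∸ k₁) (l ∸ l₁)

mono₂ : ℤ → ℕ → ℕ → Series₂
mono₂ c α β k l = if (k ≡ᵇ α) ∧ (l ≡ᵇ β) then c else 0ℤ

1₂ : Series₂
1₂ = mono₂ 1ℤ 0 0

⊛₂-cong : ∀ {p p′ q q′} → p ≈₂ p′ → q ≈₂ q′ → p ⊛₂ q ≈₂ p′ ⊛₂ q′
⊛₂-cong p≈p′ q≈q′ k l =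
  Σ≤-cong k λ k₁ _ → Σ≤-cong l λ l₁ _ → cong₂ ℤ._*_ (p≈p′ _ _) (q≈q′ _ _)

⊛₂-congˡ : ∀ p {q q′} → q ≈₂ q′ → p ⊛₂ q ≈₂ p ⊛₂ q′
⊛₂-congˡ p = ⊛₂-cong {p} (λ _ _ → refl)

⊛₂-congʳ : ∀ {p p′} q → p ≈₂ p′ → p ⊛₂ q ≈₂ p′ ⊛₂ q
⊛₂-congʳ q p≈p′ = ⊛₂-cong {q = q} p≈p′ (λ _ _ → refl)

⊛₂-zeroˡ : ∀ {p} q → p ≈₂ 0₂ → p ⊛₂ q ≈₂ 0₂
⊛₂-zeroˡ q p≈0 k l = Σ≤-zero k λ k₁ _ → Σ≤-zero l λ l₁ _ →
  cong (ℤ._* q (k ∸ k₁) (l ∸ l₁)) (p≈0 k₁ l₁)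

⊛₂-zeroʳ : ∀ p {q} → q ≈₂ 0₂ → p ⊛₂ q ≈₂ 0₂
⊛₂-zeroʳ p q≈0 k l = Σ≤-zero k λ k₁ _ → Σ≤-zero l λ l₁ _ →
  trans (cong (p k₁ l₁ ℤ.*_) (q≈0 _ _)) (ℤ.*-zeroʳ (p k₁ l₁))

⊛₂-negˡ : ∀ p q → (⊖₂ p) ⊛₂ q ≈₂ ⊖₂ (p ⊛₂ q)
⊛₂-negˡ p q k l = trans
  (Σ≤-cong k λ k₁ _ → trans (Σ≤-cong l λ l₁ _ → sym (ℤ.neg-distribˡ-* (p k₁ l₁) _)) (Σ≤-neg l _))
  (Σ≤-neg k _)

⊛₂-negʳ : ∀ p q → p ⊛₂ (⊖₂ q) ≈₂ ⊖₂ (p ⊛₂ q)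
⊛₂-negʳ p q k l = trans
  (Σ≤-cong k λ k₁ _ → trans (Σ≤-cong l λ l₁ _ → sym (ℤ.neg-distribʳ-* (p k₁ l₁) _)) (Σ≤-neg l _))
  (Σ≤-neg k _)

mono₂-diag : ∀ c α β → mono₂ c α β α β ≡ c
mono₂-diag c α β rewrite ≡ᵇ-refl α | ≡ᵇ-refl β = refl

mono₂-offᵏ : ∀ c α β k l → k ≢ α → mono₂ c α β k l ≡ 0ℤ
mono₂-offᵏ c α β k l k≢α rewrite ≢⇒≡ᵇ-false k≢α = refl

mono₂-offˡ : ∀ c α β k l → l ≢ β → mono₂ c α β k l ≡ 0ℤ
mono₂-offˡ c α β k l l≢β rewrite ≢⇒≡ᵇ-false l≢β | Bool.∧-zeroʳ (k ≡ᵇ α) = refl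

mono₂-⊛₂-≤ : ∀ c α β q k l → α ≤ k → β ≤ l →
  (mono₂ c α β ⊛₂ q) k l ≡ c ℤ.* q (k ∸ α) (l ∸ β)
mono₂-⊛₂-≤ c α β q k l α≤k β≤l =
  trans (Σ≤-single k α α≤k λ k₁ _ k₁≢α → Σ≤-zero l λ l₁ _ →
           cong (ℤ._* q (k ∸ k₁) (l ∸ l₁)) (mono₂-offᵏ c α β k₁ l₁ k₁≢α))
  (trans (Σ≤-single l β β≤l λ l₁ _ l₁≢β →
            cong (ℤ._* q (k ∸ α) (l ∸ l₁)) (mono₂-offˡ c α β α l₁ l₁≢β))
         (cong (ℤ._* q (k ∸ α) (l ∸ β)) (mono₂-diag c α β)))

mono₂-⊛₂-< : ∀ c α β q k l → k < α ⊎ l < β → (mono₂ c α β ⊛₂ q) k l ≡ 0ℤ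
mono₂-⊛₂-< c α β q k l (inj₁ k<α) = Σ≤-zero k λ k₁ k₁≤k → Σ≤-zero l λ l₁ _ →
  cong (ℤ._* q (k ∸ k₁) (l ∸ l₁)) (mono₂-offᵏ c α β k₁ l₁ (ℕ.<⇒≢ (ℕ.≤-<-trans k₁≤k k<α)))
mono₂-⊛₂-< c α β q k l (inj₂ l<β) = Σ≤-zero k λ k₁ _ → Σ≤-zero l λ l₁ l₁≤l →
  cong (ℤ._* q (k ∸ k₁) (l ∸ l₁)) (mono₂-offˡ c α β k₁ l₁ (ℕ.<⇒≢ (ℕ.≤-<-trans l₁≤l l<β)))

mono₂-⊛₂ : ∀ c α β c′ α′ β′ → mono₂ c α β ⊛₂ mono₂ c′ α′ β′ ≈₂ mono₂ (c ℤ.* c′) (α + α′) (β + β′)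
mono₂-⊛₂ c α β c′ α′ β′ k l with α ℕ.≤? k | β ℕ.≤? l
... | no α≰k | _ = trans (mono₂-⊛₂-< c α β (mono₂ c′ α′ β′) k l (inj₁ (ℕ.≰⇒> α≰k)))
                         (sym (mono₂-offᵏ _ _ _ k l λ { refl → α≰k (ℕ.m≤m+n α α′) }))
... | yes _ | no β≰l = trans (mono₂-⊛₂-< c α β (mono₂ c′ α′ β′) k l (inj₂ (ℕ.≰⇒> β≰l)))
                             (sym (mono₂-offˡ _ _ _ k l λ { refl → β≰l (ℕ.m≤m+n β β′) }))
... | yes α≤k | yes β≤l = trans (mono₂-⊛₂-≤ c α β (mono₂ c′ α′ β′) k l α≤k β≤l)
                                (product-value (k ℕ.≟ α + α′) (l ℕ.≟ β + β′))
  where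
  ∸-≢ : ∀ {a b e} → a ≤ b → b ≢ a + e → b ∸ a ≢ e
  ∸-≢ a≤b b≢a+e refl = b≢a+e (sym (ℕ.m+[n∸m]≡n a≤b))

  product-value : _ → _ → c ℤ.* mono₂ c′ α′ β′ (k ∸ α) (l ∸ β) ≡ mono₂ (c ℤ.* c′) (α + α′) (β + β′) k l
  product-value (yes refl) (yes refl) = trans
    (cong (c ℤ.*_) (trans (cong₂ (mono₂ c′ α′ β′) (ℕ.m+n∸m≡n α α′) (ℕ.m+n∸m≡n β β′)) (mono₂-diag c′ α′ β′)))
    (sym (mono₂-diag (c ℤ.* c′) (α + α′) (β + β′)))
  product-value (no k≢) _ =
    trans (cong (c ℤ.*_) (mono₂-offᵏ c′ α′ β′ (k ∸ α) (l ∸ β) (∸-≢ α≤k k≢)))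
          (trans (ℤ.*-zeroʳ c) (sym (mono₂-offᵏ (c ℤ.* c′) (α + α′) (β + β′) k l k≢)))
  product-value (yes _) (no l≢) =
    trans (cong (c ℤ.*_) (mono₂-offˡ c′ α′ β′ (k ∸ α) (l ∸ β) (∸-≢ β≤l l≢)))
          (trans (ℤ.*-zeroʳ c) (sym (mono₂-offˡ (c ℤ.* c′) (α + α′) (β + β′) k l l≢)))

-- The coefficient of aᵏ bˡ in Q ⊛₂ D is Q k l · D 0 0 plus coefficients of Q known by induction.
⊛₂-cancelʳ : ∀ {Q Q′} D → ℤ.NonZero (D 0 0) → Q ⊛₂ D ≈₂ Q′ ⊛₂ D → Q ≈₂ Q′
⊛₂-cancelʳ {Q} {Q′} D D₀₀≢0 QD≈Q′D = <-rec (λ k → ∀ l → Q k l ≡ Q′ k l) row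
  where
  row : ∀ k → (∀ {k′} → k′ < k → ∀ l → Q k′ l ≡ Q′ k′ l) → ∀ l → Q k l ≡ Q′ k l
  row k earlier-rows = <-rec (λ l → Q k l ≡ Q′ k l) entry
    where
    entry : ∀ l → (∀ {l′} → l′ < l → Q k l′ ≡ Q′ k l′) → Q k l ≡ Q′ k l
    entry l earlier-entries = ℤ.*-cancelʳ-≡ (Q k l) (Q′ k l) (D 0 0) {{D₀₀≢0}}
      (subst (λ d → Q k l ℤ.* d ≡ Q′ k l ℤ.* d) (cong₂ D (ℕ.n∸n≡0 k) (ℕ.n∸n≡0 l)) last-terms)
      where
      last-row : Σ≤ l (λ l₁ → Q k l₁ ℤ.* D (k ∸ k) (l ∸ l₁)) ≡ Σ≤ l (λ l₁ → Q′ k l₁ ℤ.* D (k ∸ k) (l ∸ l₁))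
      last-row = Σ≤-cancel-last k (λ k₁ k₁<k → Σ≤-cong l λ l₁ _ →
                   cong (ℤ._* D (k ∸ k₁) (l ∸ l₁)) (earlier-rows k₁<k l₁)) (QD≈Q′D k l)
      last-terms : Q k l ℤ.* D (k ∸ k) (l ∸ l) ≡ Q′ k l ℤ.* D (k ∸ k) (l ∸ l)
      last-terms = Σ≤-cancel-last l (λ l₁ l₁<l →
                     cong (ℤ._* D (k ∸ k) (l ∸ l₁)) (earlier-entries l₁<l)) last-row

prod₂ : List Series₂ → Series₂
prod₂ = foldr _⊛₂_ 1₂

prod₂-nonZero : ∀ {A : Set} (f : A → Series₂) {xs} →
  All (λ x → ℤ.NonZero (f x 0 0)) xs → ℤ.NonZero (prod₂ (map f xs) 0 0)
prod₂-nonZero f []                 = _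
prod₂-nonZero f {x ∷ xs} (nz ∷ nzs) = ℤ.i*j≢0 (f x 0 0) _ {{nz}} {{prod₂-nonZero f nzs}}

⊖₂^ : ℕ → Series₂ → Series₂
⊖₂^ zero    p = p
⊖₂^ (suc n) p = ⊖₂ ⊖₂^ n p

⊖₂^-cong : ∀ n {p q} → p ≈₂ q → ⊖₂^ n p ≈₂ ⊖₂^ n q
⊖₂^-cong zero    p≈q = p≈q
⊖₂^-cong (suc n) p≈q k l = cong ℤ.-_ (⊖₂^-cong n p≈q k l)

⊛₂-⊖₂^ʳ : ∀ n p q → p ⊛₂ ⊖₂^ n q ≈₂ ⊖₂^ n (p ⊛₂ q)
⊛₂-⊖₂^ʳ zero    p q k l = refl
⊛₂-⊖₂^ʳ (suc n) p q k l = trans (⊛₂-negʳ p (⊖₂^ n q) k l) (cong ℤ.-_ (⊛₂-⊖₂^ʳ n p q k l))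

prod₂-map-⊖₂ : ∀ {A : Set} (f : A → Series₂) xs →
  prod₂ (map (⊖₂_ ∘ f) xs) ≈₂ ⊖₂^ (length xs) (prod₂ (map f xs))
prod₂-map-⊖₂ f []       k l = refl
prod₂-map-⊖₂ f (x ∷ xs) k l =
  trans (⊛₂-congˡ (⊖₂ f x) (prod₂-map-⊖₂ f xs) k l)
  (trans (⊛₂-negˡ (f x) (⊖₂^ (length xs) (prod₂ (map f xs))) k l)
         (cong ℤ.-_ (⊛₂-⊖₂^ʳ (length xs) (f x) (prod₂ (map f xs)) k l)))

quotient-map-⊖₂ : ∀ {A : Set} Q (f : A → Series₂) xs ys → length xs ≡ length ys →
  Q ⊛₂ prod₂ (map f xs) ≈₂ prod₂ (map f ys) →
  Q ⊛₂ prod₂ (map (⊖₂_ ∘ f) xs) ≈₂ prod₂ (map (⊖₂_ ∘ f) ys)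
quotient-map-⊖₂ Q f xs ys |xs|≡|ys| quotient k l = begin
  (Q ⊛₂ prod₂ (map (⊖₂_ ∘ f) xs)) k l           ≡⟨ ⊛₂-congˡ Q (prod₂-map-⊖₂ f xs) k l ⟩
  (Q ⊛₂ ⊖₂^ (length xs) (prod₂ (map f xs))) k l ≡⟨ ⊛₂-⊖₂^ʳ (length xs) Q (prod₂ (map f xs)) k l ⟩
  ⊖₂^ (length xs) (Q ⊛₂ prod₂ (map f xs)) k l   ≡⟨ ⊖₂^-cong (length xs) quotient k l ⟩
  ⊖₂^ (length xs) (prod₂ (map f ys)) k l        ≡⟨ cong (λ n → ⊖₂^ n (prod₂ (map f ys)) k l) |xs|≡|ys| ⟩
  ⊖₂^ (length ys) (prod₂ (map f ys)) k l        ≡⟨ prod₂-map-⊖₂ f ys k l ⟨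
  prod₂ (map (⊖₂_ ∘ f) ys) k l                  ∎
  where open ≡-Reasoning

∸≡⇒+≡ : ∀ {m n o} → m ≤ n → n ∸ m ≡ o → m + o ≡ n
∸≡⇒+≡ m≤n refl = ℕ.m+[n∸m]≡n m≤n

-- ℤ[[a,b]][[t]], where t will be x or y.
Series₃ : Set
Series₃ = ℕ → Series₂

infix  4 _≈₃_
infixl 7 _⊛₃_

_≈₃_ : Series₃ → Series₃ → Set
R ≈₃ R′ = ∀ i → R i ≈₂ R′ i

_⊛₃_ : Series₃ → Series₃ → Series₃
(S ⊛₃ R) i k l = Σ≤ i λ i₁ → (S i₁ ⊛₂ R (i ∸ i₁)) k l

Term₃ : ℕ → Series₂ → Series₃ → Set
Term₃ e q R = (∀ i → i ≢ e → R i ≈₂ 0₂) × R e ≈₂ q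

Term₃-cong : ∀ {e e′ q q′ R R′} → e ≡ e′ → q ≈₂ q′ → R ≈₃ R′ → Term₃ e q R → Term₃ e′ q′ R′
Term₃-cong refl q≈q′ R≈R′ (off , at) =
  (λ i i≢e k l → trans (sym (R≈R′ i k l)) (off i i≢e k l)) ,
  (λ k l → trans (sym (R≈R′ _ k l)) (trans (at k l) (q≈q′ k l)))

Term₃-⊝ : ∀ {e q q′ R R′} → Term₃ e q R → Term₃ e q′ R′ → Term₃ e (q ⊝₂ q′) (λ i → R i ⊝₂ R′ i)
Term₃-⊝ (off , at) (off′ , at′) =
  (λ i i≢e k l → cong₂ ℤ._-_ (off i i≢e k l) (off′ i i≢e k l)) ,
  (λ k l → cong₂ ℤ._-_ (at k l) (at′ k l))

⊛₃-Term₃-< : ∀ S {e q R} → Term₃ e q R → ∀ {i} → i < e → (S ⊛₃ R) i ≈₂ 0₂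
⊛₃-Term₃-< S (off , _) {i} i<e k l = Σ≤-zero i λ i₁ _ →
  ⊛₂-zeroʳ (S i₁) (off (i ∸ i₁) (ℕ.<⇒≢ (ℕ.≤-<-trans (ℕ.m∸n≤m i i₁) i<e))) k l

⊛₃-Term₃-at : ∀ S {e q R} → Term₃ e q R → ∀ t → (S ⊛₃ R) (t + e) ≈₂ S t ⊛₂ q
⊛₃-Term₃-at S {e} {q} {R} (off , at) t k l =
  trans (Σ≤-single (t + e) t (ℕ.m≤m+n t e) λ i₁ i₁≤t+e i₁≢t → ⊛₂-zeroʳ (S i₁) (off _ λ t+e∸i₁≡e →
           i₁≢t (ℕ.+-cancelʳ-≡ e i₁ t (∸≡⇒+≡ i₁≤t+e t+e∸i₁≡e))) k l)
        (trans (cong (λ r → (S t ⊛₂ R r) k l) (ℕ.m+n∸m≡n t e)) (⊛₂-congˡ (S t) at k l))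

Term₃-⊛₃ : ∀ {e q S e′ q′ R} → Term₃ e q S → Term₃ e′ q′ R → Term₃ (e + e′) (q ⊛₂ q′) (S ⊛₃ R)
Term₃-⊛₃ {e} {q} {S} {e′} {q′} {R} (off , at) R-term@(off′ , _) =
  (λ n n≢e+e′ k l → Σ≤-zero n λ i₁ i₁≤n → summand-zero n n≢e+e′ i₁ i₁≤n k l) ,
  (λ k l → trans (⊛₃-Term₃-at S R-term e k l) (⊛₂-congʳ q′ at k l))
  where
  summand-zero : ∀ n → n ≢ e + e′ → ∀ i₁ → i₁ ≤ n → S i₁ ⊛₂ R (n ∸ i₁) ≈₂ 0₂
  summand-zero n n≢e+e′ i₁ i₁≤n with i₁ ℕ.≟ e
  ... | no i₁≢e  = ⊛₂-zeroˡ (R (n ∸ i₁)) (off i₁ i₁≢e)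
  ... | yes refl = ⊛₂-zeroʳ (S i₁) (off′ (n ∸ i₁) λ n∸e≡e′ → n≢e+e′ (sym (∸≡⇒+≡ i₁≤n n∸e≡e′)))

-- Leading terms in y and in x

infix 4 _≈_

_≈_ : Series → Series → Set
S ≈ S′ = ∀ i j k l → S i j k l ≡ S′ i j k l

∸-<-bound : ∀ {m n o} → m ≤ n → n < m + o → n ∸ m < o
∸-<-bound {m} {n} {o} m≤n n<m+o =
  ℕ.+-cancelˡ-< m (n ∸ m) o (subst (_< m + o) (sym (ℕ.m+[n∸m]≡n m≤n)) n<m+o)

split-below-sum : ∀ {s r m n} → m ≤ n → n < s + r → m < s ⊎ n ∸ m < r
split-below-sum {s} {r} {m} m≤n n<s+r with m ℕ.<? s
... | yes m<s = inj₁ m<s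
... | no m≮s  = inj₂ (∸-<-bound m≤n (ℕ.<-≤-trans n<s+r (ℕ.+-monoˡ-≤ r (ℕ.≮⇒≥ m≮s))))

split-off-sum : ∀ {s r m} → m ≤ s + r → m ≢ s → m < s ⊎ s + r ∸ m < r
split-off-sum {s} {r} {m} m≤s+r m≢s with m ℕ.<? s
... | yes m<s = inj₁ m<s
... | no m≮s  = inj₂ (∸-<-bound m≤s+r (ℕ.+-monoˡ-< r (ℕ.≤∧≢⇒< (ℕ.≮⇒≥ m≮s) (m≢s ∘ sym))))

yCoeff : Series → ℕ → Series₃
yCoeff S m i k l = S i m k l

YOrder≥ : ℕ → Series → Set
YOrder≥ s S = ∀ i j k l → j < s → S i j k l ≡ 0ℤ

YOrder≥-zero : ∀ S → YOrder≥ 0 S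
YOrder≥-zero S i j k l ()

⊛₂-YOrder≥ : ∀ {s r S R} → YOrder≥ s S → YOrder≥ r R → ∀ {i₁ j₁ i₂ j₂} → j₁ < s ⊎ j₂ < r →
  S i₁ j₁ ⊛₂ R i₂ j₂ ≈₂ 0₂
⊛₂-YOrder≥ {R = R} S-ord _ {i₁} {j₁} {i₂} {j₂} (inj₁ j₁<s) =
  ⊛₂-zeroˡ (R i₂ j₂) λ k l → S-ord i₁ j₁ k l j₁<s
⊛₂-YOrder≥ {S = S} _ R-ord {i₁} {j₁} {i₂} {j₂} (inj₂ j₂<r) =
  ⊛₂-zeroʳ (S i₁ j₁) λ k l → R-ord i₂ j₂ k l j₂<r

⊛-YOrder≥ : ∀ {s r S R} → YOrder≥ s S → YOrder≥ r R → YOrder≥ (s + r) (S ⊛ R)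
⊛-YOrder≥ S-ord R-ord i j k l j<s+r = Σ≤-zero i λ _ _ → Σ≤-zero j λ j₁ j₁≤j →
  ⊛₂-YOrder≥ S-ord R-ord (split-below-sum j₁≤j j<s+r) k l

⊛-yCoeff : ∀ {s r S R} → YOrder≥ s S → YOrder≥ r R →
  yCoeff (S ⊛ R) (s + r) ≈₃ yCoeff S s ⊛₃ yCoeff R r
⊛-yCoeff {s} {r} {S} {R} S-ord R-ord i k l = Σ≤-cong i λ i₁ _ →
  trans (Σ≤-single (s + r) s (ℕ.m≤m+n s r) λ j₁ j₁≤s+r j₁≢s →
           ⊛₂-YOrder≥ S-ord R-ord (split-off-sum j₁≤s+r j₁≢s) k l)
        (cong (λ j₂ → (S i₁ s ⊛₂ R (i ∸ i₁) j₂) k l) (ℕ.m+n∸m≡n s r))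

xCoeff : Series → ℕ → Series₃
xCoeff S m j k l = S m j k l

XOrder≥ : ℕ → Series → Set
XOrder≥ s S = ∀ i j k l → i < s → S i j k l ≡ 0ℤ

XOrder≥-zero : ∀ S → XOrder≥ 0 S
XOrder≥-zero S i j k l ()

⊛₂-XOrder≥ : ∀ {s r S R} → XOrder≥ s S → XOrder≥ r R → ∀ {i₁ j₁ i₂ j₂} → i₁ < s ⊎ i₂ < r →
  S i₁ j₁ ⊛₂ R i₂ j₂ ≈₂ 0₂
⊛₂-XOrder≥ {R = R} S-ord _ {i₁} {j₁} {i₂} {j₂} (inj₁ i₁<s) =
  ⊛₂-zeroˡ (R i₂ j₂) λ k l → S-ord i₁ j₁ k l i₁<s
⊛₂-XOrder≥ {S = S} _ R-ord {i₁} {j₁} {i₂} {j₂} (inj₂ i₂<r) =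
  ⊛₂-zeroʳ (S i₁ j₁) λ k l → R-ord i₂ j₂ k l i₂<r

⊛-XOrder≥ : ∀ {s r S R} → XOrder≥ s S → XOrder≥ r R → XOrder≥ (s + r) (S ⊛ R)
⊛-XOrder≥ S-ord R-ord i j k l i<s+r = Σ≤-zero i λ i₁ i₁≤i → Σ≤-zero j λ _ _ →
  ⊛₂-XOrder≥ S-ord R-ord (split-below-sum i₁≤i i<s+r) k l

⊛-xCoeff : ∀ {s r S R} → XOrder≥ s S → XOrder≥ r R →
  xCoeff (S ⊛ R) (s + r) ≈₃ xCoeff S s ⊛₃ xCoeff R r
⊛-xCoeff {s} {r} {S} {R} S-ord R-ord j k l =
  trans (Σ≤-single (s + r) s (ℕ.m≤m+n s r) λ i₁ i₁≤s+r i₁≢s → Σ≤-zero j λ _ _ →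
           ⊛₂-XOrder≥ S-ord R-ord (split-off-sum i₁≤s+r i₁≢s) k l)
        (cong (λ i₂ → Σ≤ j λ j₁ → (S s j₁ ⊛₂ R i₂ (j ∸ j₁)) k l) (ℕ.m+n∸m≡n s r))

mono-offⁱ : ∀ c e₁ e₂ e₃ e₄ i j k l → i ≢ e₁ → mono c e₁ e₂ e₃ e₄ i j k l ≡ 0ℤ
mono-offⁱ c e₁ e₂ e₃ e₄ i j k l i≢e₁ rewrite ≢⇒≡ᵇ-false i≢e₁ = refl

mono-offʲ : ∀ c e₁ e₂ e₃ e₄ i j k l → j ≢ e₂ → mono c e₁ e₂ e₃ e₄ i j k l ≡ 0ℤ
mono-offʲ c e₁ e₂ e₃ e₄ i j k l j≢e₂ rewrite ≢⇒≡ᵇ-false j≢e₂ | Bool.∧-zeroʳ (i ≡ᵇ e₁) = refl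

mono-diag : ∀ c e₁ e₂ e₃ e₄ k l → mono c e₁ e₂ e₃ e₄ e₁ e₂ k l ≡ mono₂ c e₃ e₄ k l
mono-diag c e₁ e₂ e₃ e₄ k l rewrite ≡ᵇ-refl e₁ | ≡ᵇ-refl e₂ = refl

-- S ≡ q xᵉ yˢ modulo yˢ⁺¹.
LeadingY : ℕ → ℕ → Series₂ → Series → Set
LeadingY s e q S = YOrder≥ s S × Term₃ e q (yCoeff S s)

LeadingY-cong : ∀ {s e e′ q q′ S} → e ≡ e′ → q ≈₂ q′ → LeadingY s e q S → LeadingY s e′ q′ S
LeadingY-cong e≡e′ q≈q′ (ord , term) = ord , Term₃-cong e≡e′ q≈q′ (λ _ _ _ → refl) term

LeadingY-⊛ : ∀ {s e q S r e′ q′ R} → LeadingY s e q S → LeadingY r e′ q′ R →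
  LeadingY (s + r) (e + e′) (q ⊛₂ q′) (S ⊛ R)
LeadingY-⊛ (S-ord , S-term) (R-ord , R-term) =
  ⊛-YOrder≥ S-ord R-ord ,
  Term₃-cong refl (λ _ _ → refl) (λ i k l → sym (⊛-yCoeff S-ord R-ord i k l)) (Term₃-⊛₃ S-term R-term)

LeadingY-⊕-higherʳ : ∀ {s e q S T} → LeadingY s e q S → YOrder≥ (suc s) T → LeadingY s e q (S ⊕ T)
LeadingY-⊕-higherʳ {S = S} (ord , term) T-ord =
  (λ i j k l j<s → cong₂ ℤ._+_ (ord i j k l j<s) (T-ord i j k l (ℕ.m≤n⇒m≤1+n j<s))) ,
  Term₃-cong refl (λ _ _ → refl) (λ i k l → trans (sym (ℤ.+-identityʳ _))
                                               (cong (ℤ._+_ (S i _ k l)) (sym (T-ord i _ k l ℕ.≤-refl)))) term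

LeadingY-⊝ : ∀ {s e q q′ S R} → LeadingY s e q S → LeadingY s e q′ R →
  LeadingY s e (q ⊝₂ q′) (S ⊕ (⊖ R))
LeadingY-⊝ (S-ord , S-term) (R-ord , R-term) =
  (λ i j k l j<s → cong₂ ℤ._-_ (S-ord i j k l j<s) (R-ord i j k l j<s)) , Term₃-⊝ S-term R-term

LeadingY-mono : ∀ c e₁ e₂ e₃ e₄ → LeadingY e₂ e₁ (mono₂ c e₃ e₄) (mono c e₁ e₂ e₃ e₄)
LeadingY-mono c e₁ e₂ e₃ e₄ =
  (λ i j k l j<e₂ → mono-offʲ c e₁ e₂ e₃ e₄ i j k l (ℕ.<⇒≢ j<e₂)) ,
  (λ i i≢e₁ k l → mono-offⁱ c e₁ e₂ e₃ e₄ i e₂ k l i≢e₁) , mono-diag c e₁ e₂ e₃ e₄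

-- S ≡ q xˢ yᵉ modulo xˢ⁺¹.
LeadingX : ℕ → ℕ → Series₂ → Series → Set
LeadingX s e q S = XOrder≥ s S × Term₃ e q (xCoeff S s)

LeadingX-cong : ∀ {s e e′ q q′ S} → e ≡ e′ → q ≈₂ q′ → LeadingX s e q S → LeadingX s e′ q′ S
LeadingX-cong e≡e′ q≈q′ (ord , term) = ord , Term₃-cong e≡e′ q≈q′ (λ _ _ _ → refl) term

LeadingX-⊛ : ∀ {s e q S r e′ q′ R} → LeadingX s e q S → LeadingX r e′ q′ R →
  LeadingX (s + r) (e + e′) (q ⊛₂ q′) (S ⊛ R)
LeadingX-⊛ (S-ord , S-term) (R-ord , R-term) =
  ⊛-XOrder≥ S-ord R-ord ,
  Term₃-cong refl (λ _ _ → refl) (λ j k l → sym (⊛-xCoeff S-ord R-ord j k l)) (Term₃-⊛₃ S-term R-term)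

LeadingX-⊕-higherˡ : ∀ {s e q S T} → XOrder≥ (suc s) T → LeadingX s e q S → LeadingX s e q (T ⊕ S)
LeadingX-⊕-higherˡ {S = S} T-ord (ord , term) =
  (λ i j k l i<s → cong₂ ℤ._+_ (T-ord i j k l (ℕ.m≤n⇒m≤1+n i<s)) (ord i j k l i<s)) ,
  Term₃-cong refl (λ _ _ → refl) (λ j k l → trans (sym (ℤ.+-identityˡ _))
                                               (cong (ℤ._+ S _ j k l) (sym (T-ord _ j k l ℕ.≤-refl)))) term

LeadingX-⊝ : ∀ {s e q q′ S R} → LeadingX s e q S → LeadingX s e q′ R →
  LeadingX s e (q ⊝₂ q′) (S ⊕ (⊖ R))
LeadingX-⊝ (S-ord , S-term) (R-ord , R-term) =
  (λ i j k l i<s → cong₂ ℤ._-_ (S-ord i j k l i<s) (R-ord i j k l i<s)) , Term₃-⊝ S-term R-term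

LeadingX-mono : ∀ c e₁ e₂ e₃ e₄ → LeadingX e₁ e₂ (mono₂ c e₃ e₄) (mono c e₁ e₂ e₃ e₄)
LeadingX-mono c e₁ e₂ e₃ e₄ =
  (λ i j k l i<e₁ → mono-offⁱ c e₁ e₂ e₃ e₄ i j k l (ℕ.<⇒≢ i<e₁)) ,
  (λ j j≢e₂ k l → mono-offʲ c e₁ e₂ e₃ e₄ e₁ j k l j≢e₂) , mono-diag c e₁ e₂ e₃ e₄

nonZero⇒≢0 : ∀ {i} → ℤ.NonZero i → i ≢ 0ℤ
nonZero⇒≢0 i≢0 refl = ℕ.NonZero.nonZero i≢0

quotient-leadingY : ∀ {P S T m D M qS qT} → P ⊛ S ≈ T → LeadingY m D qS S → LeadingY m M qT T →
  ℤ.NonZero (qT 0 0) → D ≤ M × (λ k l → P (M ∸ D) 0 k l) ⊛₂ qS ≈₂ qT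
quotient-leadingY {P} {S} {T} {m} {D} {M} {qS} {qT} PS≈T (S-ord , S-term) (_ , _ , T-at) qT₀₀≢0 =
  D≤M , λ k l → begin
    (P (M ∸ D) 0 ⊛₂ qS) k l                     ≡⟨ ⊛₃-Term₃-at (yCoeff P 0) S-term (M ∸ D) k l ⟨
    (yCoeff P 0 ⊛₃ yCoeff S m) (M ∸ D + D) k l  ≡⟨ PS-coeff (M ∸ D + D) k l ⟨
    (P ⊛ S) (M ∸ D + D) m k l                   ≡⟨ PS≈T _ m k l ⟩
    T (M ∸ D + D) m k l                         ≡⟨ cong (λ i → T i m k l) (ℕ.m∸n+n≡m D≤M) ⟩
    T M m k l                                   ≡⟨ T-at k l ⟩
    qT k l                                      ∎
  where
  open ≡-Reasoning
  PS-coeff : yCoeff (P ⊛ S) m ≈₃ yCoeff P 0 ⊛₃ yCoeff S m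
  PS-coeff = ⊛-yCoeff (YOrder≥-zero P) S-ord
  D≤M : D ≤ M
  D≤M with D ℕ.≤? M
  ... | yes D≤M = D≤M
  ... | no D≰M  = contradiction qT₀₀≡0 (nonZero⇒≢0 qT₀₀≢0)
    where
    qT₀₀≡0 : qT 0 0 ≡ 0ℤ
    qT₀₀≡0 = trans (sym (T-at 0 0)) (trans (sym (PS≈T M m 0 0))
               (trans (PS-coeff M 0 0) (⊛₃-Term₃-< (yCoeff P 0) S-term (ℕ.≰⇒> D≰M) 0 0)))

quotient-leadingX : ∀ {P S T m D M qS qT} → P ⊛ S ≈ T → LeadingX m D qS S → LeadingX m M qT T →
  ℤ.NonZero (qT 0 0) → D ≤ M × (λ k l → P 0 (M ∸ D) k l) ⊛₂ qS ≈₂ qT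
quotient-leadingX {P} {S} {T} {m} {D} {M} {qS} {qT} PS≈T (S-ord , S-term) (_ , _ , T-at) qT₀₀≢0 =
  D≤M , λ k l → begin
    (P 0 (M ∸ D) ⊛₂ qS) k l                     ≡⟨ ⊛₃-Term₃-at (xCoeff P 0) S-term (M ∸ D) k l ⟨
    (xCoeff P 0 ⊛₃ xCoeff S m) (M ∸ D + D) k l  ≡⟨ PS-coeff (M ∸ D + D) k l ⟨
    (P ⊛ S) m (M ∸ D + D) k l                   ≡⟨ PS≈T m _ k l ⟩
    T m (M ∸ D + D) k l                         ≡⟨ cong (λ j → T m j k l) (ℕ.m∸n+n≡m D≤M) ⟩
    T m M k l                                   ≡⟨ T-at k l ⟩
    qT k l                                      ∎
  where
  open ≡-Reasoning
  PS-coeff : xCoeff (P ⊛ S) m ≈₃ xCoeff P 0 ⊛₃ xCoeff S m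
  PS-coeff = ⊛-xCoeff (XOrder≥-zero P) S-ord
  D≤M : D ≤ M
  D≤M with D ℕ.≤? M
  ... | yes D≤M = D≤M
  ... | no D≰M  = contradiction qT₀₀≡0 (nonZero⇒≢0 qT₀₀≢0)
    where
    qT₀₀≡0 : qT 0 0 ≡ 0ℤ
    qT₀₀≡0 = trans (sym (T-at 0 0)) (trans (sym (PS≈T m M 0 0))
               (trans (PS-coeff M 0 0) (⊛₃-Term₃-< (xCoeff P 0) S-term (ℕ.≰⇒> D≰M) 0 0)))

-- The iterates of φ

substXY-substXY : ∀ F G P Q e →
  substXY F G (substXY P Q e) ≡ substXY (substXY F G P) (substXY F G Q) e
substXY-substXY F G P Q (var vx) = refl
substXY-substXY F G P Q (var vy) = refl
substXY-substXY F G P Q (var va) = refl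
substXY-substXY F G P Q (var vb) = refl
substXY-substXY F G P Q (con c)  = refl
substXY-substXY F G P Q (e :+ f) = cong₂ _:+_ (substXY-substXY F G P Q e) (substXY-substXY F G P Q f)
substXY-substXY F G P Q (e :* f) = cong₂ _:*_ (substXY-substXY F G P Q e) (substXY-substXY F G P Q f)
substXY-substXY F G P Q (:- e)   = cong :-_ (substXY-substXY F G P Q e)

F G : ℕ → Expr
F n = proj₁ (iter n)
G n = proj₂ (iter n)

F-suc : ∀ n → F (suc n) ≡ substXY (F n) (G n) F₁
G-suc : ∀ n → G (suc n) ≡ substXY (F n) (G n) G₁
F-suc zero    = refl
F-suc (suc n) = trans (cong (substXY F₁ G₁) (F-suc n)) (substXY-substXY F₁ G₁ (F n) (G n) F₁)
G-suc zero    = refl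
G-suc (suc n) = trans (cong (substXY F₁ G₁) (G-suc n)) (substXY-substXY F₁ G₁ (F n) (G n) G₁)

2^+2^≡2^suc : ∀ n → 2 ^ n + 2 ^ n ≡ 2 ^ suc n
2^+2^≡2^suc n = cong (_+_ (2 ^ n)) (sym (ℕ.+-identityʳ (2 ^ n)))

2^+[2^∸1]≡2^suc∸1 : ∀ n → 2 ^ n + (2 ^ n ∸ 1) ≡ 2 ^ suc n ∸ 1
2^+[2^∸1]≡2^suc∸1 n = trans (sym (ℕ.+-∸-assoc (2 ^ n) (ℕ.m^n>0 2 n))) (cong (_∸ 1) (2^+2^≡2^suc n))

1+[2^∸1]≡2^ : ∀ n → 1 + (2 ^ n ∸ 1) ≡ 2 ^ n
1+[2^∸1]≡2^ n = ℕ.m+[n∸m]≡n (ℕ.m^n>0 2 n)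

-- F (1 + n) = F n · F n + a · F n · G n and G (1 + n) = b · F n · G n + G n · G n, and the leading
-- summand is decided by G n having y-order 1 and F n having x-order 1.
F-leadingY : ∀ n → LeadingY 0 (2 ^ n) 1₂ ⟦ F n ⟧
G-leadingY : ∀ n → LeadingY 1 (2 ^ n ∸ 1) (mono₂ 1ℤ 0 n) ⟦ G n ⟧
F-leadingY zero    = LeadingY-mono 1ℤ 1 0 0 0
F-leadingY (suc n) = subst (LeadingY 0 (2 ^ suc n) 1₂ ∘ ⟦_⟧) (sym (F-suc n))
  (LeadingY-cong (2^+2^≡2^suc n) (mono₂-⊛₂ 1ℤ 0 0 1ℤ 0 0)
    (LeadingY-⊕-higherʳ (LeadingY-⊛ (F-leadingY n) (F-leadingY n))
                        (⊛-YOrder≥ (YOrder≥-zero (⟦ A ⟧ ⊛ ⟦ F n ⟧)) (proj₁ (G-leadingY n)))))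
G-leadingY zero    = LeadingY-mono 1ℤ 0 1 0 0
G-leadingY (suc n) = subst (LeadingY 1 (2 ^ suc n ∸ 1) (mono₂ 1ℤ 0 (suc n)) ∘ ⟦_⟧) (sym (G-suc n))
  (LeadingY-cong (2^+[2^∸1]≡2^suc∸1 n)
    (λ k l → trans (⊛₂-congʳ (mono₂ 1ℤ 0 n) (mono₂-⊛₂ 1ℤ 0 1 1ℤ 0 0) k l) (mono₂-⊛₂ 1ℤ 0 1 1ℤ 0 n k l))
    (LeadingY-⊕-higherʳ
      (LeadingY-⊛ (LeadingY-⊛ (LeadingY-mono 1ℤ 0 0 0 1) (F-leadingY n)) (G-leadingY n))
      (⊛-YOrder≥ (proj₁ (G-leadingY n)) (proj₁ (G-leadingY n)))))

F-leadingX : ∀ n → LeadingX 1 (2 ^ n ∸ 1) (mono₂ 1ℤ n 0) ⟦ F n ⟧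
G-leadingX : ∀ n → LeadingX 0 (2 ^ n) 1₂ ⟦ G n ⟧
F-leadingX zero    = LeadingX-mono 1ℤ 1 0 0 0
F-leadingX (suc n) = subst (LeadingX 1 (2 ^ suc n ∸ 1) (mono₂ 1ℤ (suc n) 0) ∘ ⟦_⟧) (sym (F-suc n))
  (LeadingX-cong (trans (ℕ.+-comm (2 ^ n ∸ 1) (2 ^ n)) (2^+[2^∸1]≡2^suc∸1 n))
    (λ k l → trans (⊛₂-congʳ 1₂ (mono₂-⊛₂ 1ℤ 1 0 1ℤ n 0) k l)
             (trans (mono₂-⊛₂ 1ℤ (suc n) 0 1ℤ 0 0 k l)
                    (cong (λ α → mono₂ 1ℤ α 0 k l) (ℕ.+-identityʳ (suc n)))))
    (LeadingX-⊕-higherˡ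
      (⊛-XOrder≥ (proj₁ (F-leadingX n)) (proj₁ (F-leadingX n)))
      (LeadingX-⊛ (LeadingX-⊛ (LeadingX-mono 1ℤ 0 0 1 0) (F-leadingX n)) (G-leadingX n))))
G-leadingX zero    = LeadingX-mono 1ℤ 0 1 0 0
G-leadingX (suc n) = subst (LeadingX 0 (2 ^ suc n) 1₂ ∘ ⟦_⟧) (sym (G-suc n))
  (LeadingX-cong (2^+2^≡2^suc n) (mono₂-⊛₂ 1ℤ 0 0 1ℤ 0 0)
    (LeadingX-⊕-higherˡ
      (⊛-XOrder≥ (⊛-XOrder≥ (XOrder≥-zero ⟦ B ⟧) (proj₁ (F-leadingX n))) (XOrder≥-zero ⟦ G n ⟧))
      (LeadingX-⊛ (G-leadingX n) (G-leadingX n))))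

constXY : Series → Series₂
constXY S k l = S 0 0 k l

constXY-pow-A : ∀ d → constXY ⟦ A :^ d ⟧ ≈₂ mono₂ 1ℤ d 0
constXY-pow-A zero    = λ _ _ → refl
constXY-pow-A (suc d) k l =
  trans (⊛₂-congʳ (mono₂ 1ℤ 1 0) (constXY-pow-A d) k l)
        (trans (mono₂-⊛₂ 1ℤ d 0 1ℤ 1 0 k l) (cong (λ α → mono₂ 1ℤ α 0 k l) (ℕ.+-comm d 1)))

constXY-pow-B : ∀ d → constXY ⟦ B :^ d ⟧ ≈₂ mono₂ 1ℤ 0 d
constXY-pow-B zero    = λ _ _ → refl
constXY-pow-B (suc d) k l =
  trans (⊛₂-congʳ (mono₂ 1ℤ 0 1) (constXY-pow-B d) k l)
        (trans (mono₂-⊛₂ 1ℤ 0 d 1ℤ 0 1 k l) (cong (λ β → mono₂ 1ℤ 0 β k l) (ℕ.+-comm d 1)))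

cycFactor : Var → ℕ → Series₂
cycFactor v d = constXY ⟦ var v :^ d :- con 1ℤ ⟧

Φ-leadingY : ∀ n → LeadingY 1 (2 ^ n) (⊖₂ cycFactor vb n) ⟦ Φ n ⟧
Φ-leadingY n = LeadingY-cong refl 1-bⁿ≈-[bⁿ-1] (LeadingY-⊝ yF xG)
  where
  yF : LeadingY 1 (2 ^ n) 1₂ ⟦ Y :* F n ⟧
  yF = LeadingY-cong refl (mono₂-⊛₂ 1ℤ 0 0 1ℤ 0 0)
         (LeadingY-⊛ (LeadingY-mono 1ℤ 0 1 0 0) (F-leadingY n))
  xG : LeadingY 1 (2 ^ n) (mono₂ 1ℤ 0 n) ⟦ X :* G n ⟧
  xG = LeadingY-cong (1+[2^∸1]≡2^ n) (mono₂-⊛₂ 1ℤ 0 0 1ℤ 0 n)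
         (LeadingY-⊛ (LeadingY-mono 1ℤ 1 0 0 0) (G-leadingY n))
  1-bⁿ≈-[bⁿ-1] : 1₂ ⊝₂ mono₂ 1ℤ 0 n ≈₂ ⊖₂ cycFactor vb n
  1-bⁿ≈-[bⁿ-1] k l = trans (sym (-[i-j]≡j-i (mono₂ 1ℤ 0 n k l) (1₂ k l)))
                           (cong (λ b → ℤ.- (b ℤ.- 1₂ k l)) (sym (constXY-pow-B n k l)))

Φ-leadingX : ∀ n → LeadingX 1 (2 ^ n) (cycFactor va n) ⟦ Φ n ⟧
Φ-leadingX n =
  LeadingX-cong refl (λ k l → cong (ℤ._- 1₂ k l) (sym (constXY-pow-A n k l))) (LeadingX-⊝ yF xG)
  where
  yF : LeadingX 1 (2 ^ n) (mono₂ 1ℤ n 0) ⟦ Y :* F n ⟧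
  yF = LeadingX-cong (1+[2^∸1]≡2^ n) (mono₂-⊛₂ 1ℤ 0 0 1ℤ n 0)
         (LeadingX-⊛ (LeadingX-mono 1ℤ 0 1 0 0) (F-leadingX n))
  xG : LeadingX 1 (2 ^ n) 1₂ ⟦ X :* G n ⟧
  xG = LeadingX-cong refl (mono₂-⊛₂ 1ℤ 0 0 1ℤ 0 0)
         (LeadingX-⊛ (LeadingX-mono 1ℤ 1 0 0 0) (G-leadingX n))

LeadingY-prodE : ∀ {A : Set} (g : A → Expr) {e : A → ℕ} {q : A → Series₂} →
  (∀ x → LeadingY 1 (e x) (q x) ⟦ g x ⟧) →
  ∀ xs → LeadingY (length xs) (sum (map e xs)) (prod₂ (map q xs)) ⟦ prodE (map g xs) ⟧
LeadingY-prodE g lead []       = LeadingY-mono 1ℤ 0 0 0 0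
LeadingY-prodE g lead (x ∷ xs) = LeadingY-⊛ (lead x) (LeadingY-prodE g lead xs)

LeadingX-prodE : ∀ {A : Set} (g : A → Expr) {e : A → ℕ} {q : A → Series₂} →
  (∀ x → LeadingX 1 (e x) (q x) ⟦ g x ⟧) →
  ∀ xs → LeadingX (length xs) (sum (map e xs)) (prod₂ (map q xs)) ⟦ prodE (map g xs) ⟧
LeadingX-prodE g lead []       = LeadingX-mono 1ℤ 0 0 0 0
LeadingX-prodE g lead (x ∷ xs) = LeadingX-⊛ (lead x) (LeadingX-prodE g lead xs)

constXY-prodE : ∀ {A : Set} (g : A → Expr) xs →
  constXY ⟦ prodE (map g xs) ⟧ ≈₂ prod₂ (map (constXY ∘ ⟦_⟧ ∘ g) xs)
constXY-prodE g []       k l = refl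
constXY-prodE g (x ∷ xs)     = ⊛₂-congˡ (constXY ⟦ g x ⟧) (constXY-prodE g xs)

var-at-0 : ∀ v → ⟦ var v ⟧ 0 0 0 0 ≡ 0ℤ
var-at-0 vx = refl
var-at-0 vy = refl
var-at-0 va = refl
var-at-0 vb = refl

cycFactor-at-0 : ∀ v d → cycFactor v (suc d) 0 0 ≡ -1ℤ
cycFactor-at-0 v d = cong (ℤ._- 1ℤ)
  (trans (cong (ℤ._*_ (⟦ var v :^ d ⟧ 0 0 0 0)) (var-at-0 v)) (ℤ.*-zeroʳ (⟦ var v :^ d ⟧ 0 0 0 0)))

cycFactor-nonZero : ∀ v {d} → 1 ≤ d → ℤ.NonZero (cycFactor v d 0 0)
cycFactor-nonZero v {suc d} _ rewrite cycFactor-at-0 v d = _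

⊖₂-cycFactor-nonZero : ∀ v {d} → 1 ≤ d → ℤ.NonZero ((⊖₂ cycFactor v d) 0 0)
⊖₂-cycFactor-nonZero v {suc d} _ rewrite cycFactor-at-0 v d = _

-- The Möbius function

if-yes : ∀ {A : Set} (a? : Dec A) {x y : ℤ} → A → (if does a? then x else y) ≡ x
if-yes a? {x} {y} a = cong (if_then x else y) (dec-true a? a)

if-no : ∀ {A : Set} (a? : Dec A) {x y : ℤ} → ¬ A → (if does a? then x else y) ≡ y
if-no a? {x} {y} ¬a = cong (if_then x else y) (dec-false a? ¬a)

indicator : ∀ {A : Set} → Dec A → ℤ
indicator a? = if does a? then 1ℤ else 0ℤ

indicator-⊎ : ∀ {A B C : Set} (a? : Dec A) (b? : Dec B) (c? : Dec C) →
  (A → B ⊎ C) → (B → A) → (C → A) → (B → ¬ C) → indicator a? ≡ indicator b? ℤ.+ indicator c?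
indicator-⊎ (yes a) (yes b) (yes c) _   _   _   b⇒¬c = contradiction c (b⇒¬c b)
indicator-⊎ (yes a) (yes b) (no ¬c) _   _   _   _    = refl
indicator-⊎ (yes a) (no ¬b) (yes c) _   _   _   _    = refl
indicator-⊎ (yes a) (no ¬b) (no ¬c) a⇒b∨c _ _ _    with a⇒b∨c a
... | inj₁ b = contradiction b ¬b
... | inj₂ c = contradiction c ¬c
indicator-⊎ (no ¬a) (yes b) _       _   b⇒a _   _    = contradiction (b⇒a b) ¬a
indicator-⊎ (no ¬a) (no ¬b) (yes c) _   _   c⇒a _    = contradiction (c⇒a c) ¬a
indicator-⊎ (no ¬a) (no ¬b) (no ¬c) _   _   _   _    = refl

T-does : ∀ {A : Set} (a? : Dec A) → A → T (does a?)
T-does a? a = Equivalence.from Bool.T-≡ (dec-true a? a)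

does-T : ∀ {A : Set} (a? : Dec A) → T (does a?) → A
does-T (yes a) _ = a

-1^-values : ∀ k → -1ℤ ℤ.^ k ≡ 1ℤ ⊎ -1ℤ ℤ.^ k ≡ -1ℤ
-1^-values zero    = inj₁ refl
-1^-values (suc k) with -1^-values k
... | inj₁ ≡1  = inj₂ (cong (-1ℤ ℤ.*_) ≡1)
... | inj₂ ≡-1 = inj₁ (cong (-1ℤ ℤ.*_) ≡-1)

μ-values : ∀ n → μ n ≡ 0ℤ ⊎ μ n ≡ 1ℤ ⊎ μ n ≡ -1ℤ
μ-values zero    = inj₁ refl
μ-values (suc n) with hasSquareFactor (suc n)
... | true  = inj₁ refl
... | false = inj₂ (-1^-values (length (primeDivisors (suc n))))

square-factor⁺ : ∀ n {q} → .{{ℕ.NonZero n}} → 2 ≤ q → q * q ∣ n → T (hasSquareFactor n)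
square-factor⁺ n {q} 2≤q q²∣n = any⁺ (λ p → does (2 ℕ.≤? p) ∧ does ((p * p) ∣? n))
  (lose (∈-upTo⁺ (s≤s q≤n)) (Equivalence.from (Bool.T-∧ {does (2 ℕ.≤? q)})
                                             (T-does (2 ℕ.≤? q) 2≤q , T-does ((q * q) ∣? n) q²∣n)))
  where
  q≤n : q ≤ n
  q≤n = ℕ.≤-trans (ℕ.m≤m*n q q {{ℕ.>-nonZero (ℕ.<-trans z<s 2≤q)}}) (∣⇒≤ q²∣n)

square-factor⁻ : ∀ n → T (hasSquareFactor n) → ∃ λ q → 2 ≤ q × q * q ∣ n
square-factor⁻ n h with satisfied (any⁻ (λ p → does (2 ℕ.≤? p) ∧ does ((p * p) ∣? n)) (upTo (suc n)) h)
... | q , 2≤q∧q²∣n with Equivalence.to (Bool.T-∧ {does (2 ℕ.≤? q)}) 2≤q∧q²∣n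
...   | 2≤q , q²∣n = q , does-T (2 ℕ.≤? q) 2≤q , does-T ((q * q) ∣? n) q²∣n

μ-squareful : ∀ n → T (hasSquareFactor n) → μ n ≡ 0ℤ
μ-squareful zero    _ = refl
μ-squareful (suc n) h rewrite Equivalence.to Bool.T-≡ h = refl

μ-squarefree : ∀ n → .{{ℕ.NonZero n}} → ¬ T (hasSquareFactor n) →
  μ n ≡ -1ℤ ℤ.^ length (primeDivisors n)
μ-squarefree (suc n) ¬h with hasSquareFactor (suc n)
... | true  = contradiction _ ¬h
... | false = refl

prime⇒2≤ : ∀ {p} → Prime p → 2 ≤ p
prime⇒2≤ {p} p-prime = ℕ.nonTrivial⇒n>1 p {{prime⇒nonTrivial p-prime}}

prime⇒≢1 : ∀ {p} → Prime p → p ≢ 1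
prime⇒≢1 p-prime refl = ℕ.<-irrefl refl (prime⇒2≤ p-prime)

square∣*prime⇒square∣ : ∀ {p e q} → Prime p → ¬ p ∣ e → q * q ∣ e * p → q * q ∣ e
square∣*prime⇒square∣ {p} {e} {q} p-prime p∤e q²∣ep =
  coprime-divisor q²-coprime-p (subst (q * q ∣_) (ℕ.*-comm e p) q²∣ep)
  where
  instance
    p≢0 : ℕ.NonZero p
    p≢0 = prime⇒nonZero p-prime
  p∣q²⇒p∣q : p ∣ q * q → p ∣ q
  p∣q²⇒p∣q p∣q² with euclidsLemma q q p-prime p∣q²
  ... | inj₁ p∣q = p∣q
  ... | inj₂ p∣q = p∣q
  q²-coprime-p : Coprime (q * q) p
  q²-coprime-p {d} (d∣q² , d∣p) with prime⇒irreducible p-prime d∣p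
  ... | inj₁ d≡1 = d≡1
  ... | inj₂ refl = contradiction (*-cancelʳ-∣ d (∣-trans (*-pres-∣ p∣q p∣q) q²∣ep)) p∤e
    where p∣q = p∣q²⇒p∣q d∣q²

isPrimeDivisor? : ∀ n q → Dec (Prime q × q ∣ n)
isPrimeDivisor? n q = prime? q ×-dec q ∣? n

+length-primeDivisors : ∀ n → + length (primeDivisors n) ≡ Σ< (suc n) (indicator ∘ isPrimeDivisor? n)
+length-primeDivisors n = trans (+length≡foldr (primeDivisors n))
                                (foldr-filter-applyUpTo (isPrimeDivisor? n) (λ _ → 1ℤ) id (suc n))

primeDivisors-*-prime : ∀ {p e} → Prime p → ¬ p ∣ e → .{{ℕ.NonZero e}} →
  length (primeDivisors (e * p)) ≡ suc (length (primeDivisors e))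
primeDivisors-*-prime {p} {e} p-prime p∤e = ℤ.+-injective (begin
  + length (primeDivisors (e * p))
    ≡⟨ +length-primeDivisors (e * p) ⟩
  Σ< (suc (e * p)) (indicator ∘ isPrimeDivisor? (e * p))
    ≡⟨ Σ<-cong (suc (e * p)) (λ q _ → indicator-split q) ⟩
  Σ< (suc (e * p)) (λ q → indicator (isPrimeDivisor? e q) ℤ.+ indicator (q ℕ.≟ p))
    ≡⟨ Σ<-+ (suc (e * p)) (indicator ∘ isPrimeDivisor? e) (λ q → indicator (q ℕ.≟ p)) ⟩
  Σ< (suc (e * p)) (indicator ∘ isPrimeDivisor? e) ℤ.+ Σ< (suc (e * p)) (λ q → indicator (q ℕ.≟ p))
    ≡⟨ cong₂ ℤ._+_ (Σ<-extend (indicator ∘ isPrimeDivisor? e) (s≤s (ℕ.m≤m*n e p {{prime⇒nonZero p-prime}}))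
                     λ q e<q → if-no (isPrimeDivisor? e q) λ (_ , q∣e) → ℕ.<⇒≱ e<q (∣⇒≤ q∣e))
                   (Σ<-single (suc (e * p)) p (λ q → indicator (q ℕ.≟ p)) (s≤s (ℕ.m≤n*m p e))
                     λ q _ q≢p → if-no (q ℕ.≟ p) q≢p) ⟩
  Σ< (suc e) (indicator ∘ isPrimeDivisor? e) ℤ.+ indicator (p ℕ.≟ p)
    ≡⟨ cong₂ ℤ._+_ (sym (+length-primeDivisors e)) (if-yes (p ℕ.≟ p) refl) ⟩
  + length (primeDivisors e) ℤ.+ 1ℤ
    ≡⟨ ℤ.+-comm (+ length (primeDivisors e)) 1ℤ ⟩
  1ℤ ℤ.+ + length (primeDivisors e)
    ≡⟨ ℤ.pos-+ 1 (length (primeDivisors e)) ⟨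
  + suc (length (primeDivisors e))
    ∎)
  where
  open ≡-Reasoning
  indicator-split : ∀ q →
    indicator (isPrimeDivisor? (e * p) q) ≡ indicator (isPrimeDivisor? e q) ℤ.+ indicator (q ℕ.≟ p)
  indicator-split q = indicator-⊎ (isPrimeDivisor? (e * p) q) (isPrimeDivisor? e q) (q ℕ.≟ p)
    split (λ (q-prime , q∣e) → q-prime , ∣-trans q∣e (m∣m*n p)) (λ { refl → p-prime , n∣m*n e })
    (λ { (_ , q∣e) refl → p∤e q∣e })
    where
    split : Prime q × q ∣ e * p → Prime q × q ∣ e ⊎ q ≡ p
    split (q-prime , q∣ep) with euclidsLemma e p q-prime q∣ep
    ... | inj₁ q∣e = inj₁ (q-prime , q∣e)
    ... | inj₂ q∣p with prime⇒irreducible p-prime q∣p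
    ...   | inj₁ q≡1 = contradiction q≡1 (prime⇒≢1 q-prime)
    ...   | inj₂ q≡p = inj₂ q≡p

μ∤ : ℕ → ℕ → ℤ
μ∤ p x = if does (p ∣? x) then 0ℤ else μ x

μ-*-prime : ∀ {p e} → Prime p → .{{ℕ.NonZero e}} → μ (e * p) ≡ ℤ.- μ∤ p e
μ-*-prime {p} {e} p-prime {{e≢0}} = by-divisibility (p ∣? e)
  where
  instance
    ep≢0 : ℕ.NonZero (e * p)
    ep≢0 = ℕ.m*n≢0 e p {{e≢0}} {{prime⇒nonZero p-prime}}
  by-squarefreeness : Dec (T (hasSquareFactor e)) → ¬ p ∣ e → μ (e * p) ≡ ℤ.- μ e
  by-squarefreeness (yes e-squareful) _ with square-factor⁻ e e-squareful
  ... | q , 2≤q , q²∣e = trans (μ-squareful (e * p) (square-factor⁺ (e * p) 2≤q (∣-trans q²∣e (m∣m*n p))))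
                               (cong ℤ.-_ (sym (μ-squareful e e-squareful)))
  by-squarefreeness (no e-squarefree) p∤e = begin
    μ (e * p)                                 ≡⟨ μ-squarefree (e * p) ep-squarefree ⟩
    -1ℤ ℤ.^ length (primeDivisors (e * p))    ≡⟨ cong (-1ℤ ℤ.^_) (primeDivisors-*-prime p-prime p∤e) ⟩
    -1ℤ ℤ.* -1ℤ ℤ.^ length (primeDivisors e)  ≡⟨ ℤ.-1*i≡-i _ ⟩
    ℤ.- (-1ℤ ℤ.^ length (primeDivisors e))    ≡⟨ cong ℤ.-_ (μ-squarefree e e-squarefree) ⟨
    ℤ.- μ e                                   ∎
    where
    open ≡-Reasoning
    ep-squarefree : ¬ T (hasSquareFactor (e * p))
    ep-squarefree ep-squareful with square-factor⁻ (e * p) ep-squareful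
    ... | q , 2≤q , q²∣ep =
      e-squarefree (square-factor⁺ e 2≤q (square∣*prime⇒square∣ {q = q} p-prime p∤e q²∣ep))
  by-divisibility : (p∣e? : Dec (p ∣ e)) → μ (e * p) ≡ ℤ.- (if does p∣e? then 0ℤ else μ e)
  by-divisibility (yes p∣e) = μ-squareful (e * p) (square-factor⁺ (e * p) (prime⇒2≤ p-prime) (*-monoˡ-∣ p p∣e))
  by-divisibility (no p∤e)  = by-squarefreeness (T? (hasSquareFactor e)) p∤e

-- Sums over divisors

prime-factor : ∀ N → 1 < N → ∃ λ p → Prime p × p ∣ N
prime-factor N 1<N with factorise N {{ℕ.>-nonZero (ℕ.<-trans z<s 1<N)}}
... | record { factors = [] ; isFactorisation = N≡1 } = contradiction N≡1 (ℕ.>⇒≢ 1<N)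
... | record { factors = p ∷ ps ; isFactorisation = N≡p*Πps ; factorsPrime = p-prime ∷ _ } =
  p , p-prime , subst (p ∣_) (sym N≡p*Πps) (m∣m*n (product ps))

quot-unique : ∀ {M t d} → .{{ℕ.NonZero t}} → d * t ≡ M → quot M t ≡ d
quot-unique {t = suc t} {d} refl = m*n/n≡m d (suc t)

quot-*-cancel : ∀ {M t} → .{{ℕ.NonZero t}} → t ∣ M → quot M t * t ≡ M
quot-*-cancel {t = t} (divides q refl) = cong (_* t) (quot-unique {d = q} refl)

a*b≡c*d⇒a≡e*d⇒c≡e*b : ∀ {a b c d e} → .{{ℕ.NonZero d}} → a * b ≡ c * d → a ≡ e * d → c ≡ e * b
a*b≡c*d⇒a≡e*d⇒c≡e*b {a} {b} {c} {d} {e} ab≡cd a≡ed =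
  ℕ.*-cancelʳ-≡ c (e * b) d (trans (sym ab≡cd) (trans (cong (_* b) a≡ed) (*-rightComm e d b)))

isDivisor? : ∀ N t → Dec (1 ≤ t × t ∣ N)
isDivisor? N t = 1 ℕ.≤? t ×-dec t ∣? N

divisorTerm : ℕ → (ℕ → ℤ) → ℕ → ℤ
divisorTerm N f t = if does (isDivisor? N t) then f t else 0ℤ

divisorSum : ℕ → (ℕ → ℤ) → ℤ
divisorSum N f = Σ< (suc N) (divisorTerm N f)

foldr-divisors : ∀ N (f : ℕ → ℤ) → foldr (λ k s → f k ℤ.+ s) 0ℤ (divisors N) ≡ divisorSum N f
foldr-divisors N f = foldr-filter-applyUpTo (isDivisor? N) f id (suc N)

N<t⇒divisorTerm≡0 : ∀ {N t} f → .{{ℕ.NonZero N}} → N < t → divisorTerm N f t ≡ 0ℤ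
N<t⇒divisorTerm≡0 {N} {t} f N<t = if-no (isDivisor? N t) λ (_ , t∣N) → ℕ.<⇒≱ N<t (∣⇒≤ t∣N)

divisorTerm-*-prime : ∀ {N N′ p} (f g : ℕ → ℤ) → .{{ℕ.NonZero p}} → N ≡ N′ * p →
  (∀ s → .{{ℕ.NonZero s}} → s ∣ N′ → f (s * p) ≡ g s) → ∀ s → divisorTerm N f (s * p) ≡ divisorTerm N′ g s
divisorTerm-*-prime {N} {N′} {p} f g N≡N′p f≡g s with isDivisor? N′ s
... | yes (1≤s , s∣N′) =
  trans (if-yes (isDivisor? N (s * p)) (1≤sp , subst (s * p ∣_) (sym N≡N′p) (*-monoˡ-∣ p s∣N′)))
        (trans (f≡g s {{ℕ.>-nonZero 1≤s}} s∣N′) (sym (if-yes (isDivisor? N′ s) (1≤s , s∣N′))))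
  where
  1≤sp : 1 ≤ s * p
  1≤sp = ℕ.>-nonZero⁻¹ (s * p) {{ℕ.m*n≢0 s p {{ℕ.>-nonZero 1≤s}}}}
... | no ¬s∣N′ =
  trans (if-no (isDivisor? N (s * p)) λ (1≤sp , sp∣N) →
           ¬s∣N′ (ℕ.>-nonZero⁻¹ s {{ℕ.m*n≢0⇒m≢0 s {{ℕ.>-nonZero 1≤sp}}}} ,
                  *-cancelʳ-∣ p (subst (s * p ∣_) N≡N′p sp∣N)))
        (sym (if-no (isDivisor? N′ s) ¬s∣N′))

divisorTerm-μ-split : ∀ {p N N′} → Prime p → N ≡ N′ * p → {{ℕ.NonZero N}} → ∀ t →
  divisorTerm N (μ ∘ quot N) t ℤ.+ divisorTerm N′ (μ∤ p ∘ quot N′) t ≡ divisorTerm N (μ∤ p ∘ quot N) t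
divisorTerm-μ-split {p} {N} {N′} p-prime N≡N′p {{N≢0}} t with isDivisor? N t
... | no ¬t∣N = trans
  (cong₂ ℤ._+_ (if-no (isDivisor? N t) ¬t∣N)
               (if-no (isDivisor? N′ t) λ (1≤t , t∣N′) →
                  ¬t∣N (1≤t , subst (t ∣_) (sym N≡N′p) (∣-trans t∣N′ (m∣m*n p)))))
  (sym (if-no (isDivisor? N t) ¬t∣N))
... | yes t∣N@(1≤t , _) = trans (cong (ℤ._+ _) (if-yes (isDivisor? N t) t∣N))
                         (trans (split (p ∣? quot N t)) (sym (if-yes (isDivisor? N t) t∣N)))
  where
  instance
    t≢0 : ℕ.NonZero t
    t≢0 = ℕ.>-nonZero 1≤t
    p≢0 : ℕ.NonZero p
    p≢0 = prime⇒nonZero p-prime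
  d : ℕ
  d = quot N t
  dt≡N′p : d * t ≡ N′ * p
  dt≡N′p = trans (quot-*-cancel (proj₂ t∣N)) N≡N′p
  split : Dec (p ∣ d) → μ d ℤ.+ divisorTerm N′ (μ∤ p ∘ quot N′) t ≡ μ∤ p d
  split (yes (divides e d≡ep)) = begin
    μ d ℤ.+ divisorTerm N′ (μ∤ p ∘ quot N′) t
      ≡⟨ cong₂ ℤ._+_ (trans (cong μ d≡ep) (μ-*-prime p-prime {{e≢0}}))
                     (if-yes (isDivisor? N′ t) (1≤t , divides e N′≡et)) ⟩
    ℤ.- μ∤ p e ℤ.+ μ∤ p (quot N′ t)  ≡⟨ cong (λ x → ℤ.- μ∤ p e ℤ.+ μ∤ p x) (quot-unique (sym N′≡et)) ⟩
    ℤ.- μ∤ p e ℤ.+ μ∤ p e            ≡⟨ ℤ.+-inverseˡ (μ∤ p e) ⟩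
    0ℤ                               ≡⟨ if-yes (p ∣? d) (divides e d≡ep) ⟨
    μ∤ p d                           ∎
    where
    open ≡-Reasoning
    N′≡et : N′ ≡ e * t
    N′≡et = a*b≡c*d⇒a≡e*d⇒c≡e*b {e = e} dt≡N′p d≡ep
    e≢0 : ℕ.NonZero e
    e≢0 = ℕ.m*n≢0⇒m≢0 e {{subst ℕ.NonZero N′≡et (ℕ.m*n≢0⇒m≢0 N′ {{subst ℕ.NonZero N≡N′p N≢0}})}}
  split (no p∤d) = trans (cong (ℤ._+_ (μ d)) (if-no (isDivisor? N′ t) λ (_ , divides s N′≡st) →
                           p∤d (divides s (a*b≡c*d⇒a≡e*d⇒c≡e*b {e = s} (sym dt≡N′p) N′≡st))))
                  (trans (ℤ.+-identityʳ (μ d)) (sym (if-no (p ∣? d) p∤d)))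

divisorSum-μ∤-*-prime : ∀ {p N N′} → Prime p → N ≡ N′ * p → {{ℕ.NonZero N}} →
  divisorSum N (μ∤ p ∘ quot N) ≡ Σ< (suc N) (divisorTerm N′ (μ∤ p ∘ quot N′))
divisorSum-μ∤-*-prime {p} {N} {N′} p-prime N≡N′p = begin
  Σ< (suc N) N-term                  ≡⟨ Σ<-extend N-term (ℕ.m≤m*n (suc N) p)
                                                   (λ _ → N<t⇒divisorTerm≡0 N-summand) ⟨
  Σ< (suc N * p) N-term              ≡⟨ Σ<-stride p (suc N) N-term N-term-off-multiples ⟩
  Σ< (suc N) (λ s → N-term (s * p))  ≡⟨ Σ<-cong (suc N) (λ s _ →
                                          divisorTerm-*-prime N-summand N′-summand N≡N′p quot-multiple s) ⟩
  Σ< (suc N) (divisorTerm N′ N′-summand) ∎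
  where
  open ≡-Reasoning
  instance
    p≢0 : ℕ.NonZero p
    p≢0 = prime⇒nonZero p-prime
  N-summand N′-summand N-term : ℕ → ℤ
  N-summand = μ∤ p ∘ quot N
  N′-summand = μ∤ p ∘ quot N′
  N-term = divisorTerm N N-summand
  N-term-off-multiples : ∀ t → ¬ p ∣ t → N-term t ≡ 0ℤ
  N-term-off-multiples t p∤t with isDivisor? N t
  ... | no ¬t∣N = if-no (isDivisor? N t) ¬t∣N
  ... | yes t∣N@(1≤t , t∣N′) = trans (if-yes (isDivisor? N t) t∣N) (if-yes (p ∣? quot N t) p∣N/t)
    where
    p∣N/t : p ∣ quot N t
    p∣N/t with euclidsLemma (quot N t) t p-prime (subst (p ∣_) (sym (quot-*-cancel {{ℕ.>-nonZero 1≤t}} t∣N′))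
                                                         (subst (p ∣_) (sym N≡N′p) (n∣m*n N′)))
    ... | inj₁ p∣N/t = p∣N/t
    ... | inj₂ p∣t   = contradiction p∣t p∤t
  quot-multiple : ∀ s → .{{ℕ.NonZero s}} → s ∣ N′ → N-summand (s * p) ≡ N′-summand s
  quot-multiple s s∣N′ = cong (μ∤ p) (quot-unique {{ℕ.m*n≢0 s p}}
    (trans (sym (ℕ.*-assoc (quot N′ s) s p)) (trans (cong (_* p) (quot-*-cancel s∣N′)) (sym N≡N′p))))

-- Write N = N′ p with p prime. Termwise μ (N / t) = μ∤ p (N / t) − μ∤ p (N′ / t), the last term being 0
-- unless t ∣ N′, and the two μ∤-sums agree because μ∤ p (N / t) vanishes unless p ∣ t.
divisorSum-μ≡0 : ∀ N → 1 < N → divisorSum N (μ ∘ quot N) ≡ 0ℤ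
divisorSum-μ≡0 N 1<N with prime-factor N 1<N
... | p , p-prime , divides N′ N≡N′p = +-cancelʳ (divisorSum N (μ∤ p ∘ quot N)) _ 0ℤ (begin
  divisorSum N (μ ∘ quot N) ℤ.+ divisorSum N (μ∤ p ∘ quot N)
    ≡⟨ cong (ℤ._+_ (divisorSum N (μ ∘ quot N))) (divisorSum-μ∤-*-prime {N′ = N′} p-prime N≡N′p) ⟩
  divisorSum N (μ ∘ quot N) ℤ.+ Σ< (suc N) N′-term
    ≡⟨ Σ<-+ (suc N) (divisorTerm N (μ ∘ quot N)) N′-term ⟨
  Σ< (suc N) (λ t → divisorTerm N (μ ∘ quot N) t ℤ.+ N′-term t)
    ≡⟨ Σ<-cong (suc N) (λ t _ → divisorTerm-μ-split {N′ = N′} p-prime N≡N′p t) ⟩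
  divisorSum N (μ∤ p ∘ quot N)
    ≡⟨ ℤ.+-identityˡ _ ⟨
  0ℤ ℤ.+ divisorSum N (μ∤ p ∘ quot N) ∎)
  where
  instance
    N≢0 : ℕ.NonZero N
    N≢0 = ℕ.>-nonZero (ℕ.<-trans z<s 1<N)
  open ≡-Reasoning
  N′-term : ℕ → ℤ
  N′-term = divisorTerm N′ (μ∤ p ∘ quot N′)

module _ (w : ℕ → ℤ) (w-values : ∀ k → w k ≡ 0ℤ ⊎ w k ≡ 1ℤ ⊎ w k ≡ -1ℤ) where

  positives negatives : List ℕ → List ℕ
  positives = filter (λ k → w k ℤ.≟ 1ℤ)
  negatives = filter (λ k → w k ℤ.≟ -1ℤ)

  signedSum-split : ∀ (g : ℕ → ℕ) xs →
    foldr (λ k s → w k ℤ.* + g k ℤ.+ s) 0ℤ xs ≡ + sum (map g (positives xs)) ℤ.- + sum (map g (negatives xs))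
  signedSum-split g []       = refl
  signedSum-split g (x ∷ xs) with w x | w-values x
  ... | .0ℤ  | inj₁ refl        = trans (ℤ.+-identityˡ _) (signedSum-split g xs)
  ... | .1ℤ  | inj₂ (inj₁ refl) = begin
    1ℤ ℤ.* + g x ℤ.+ foldr (λ k s → w k ℤ.* + g k ℤ.+ s) 0ℤ xs
      ≡⟨ cong₂ ℤ._+_ (ℤ.*-identityˡ (+ g x)) (signedSum-split g xs) ⟩
    + g x ℤ.+ (+ P ℤ.- + M)  ≡⟨ ℤ.+-assoc (+ g x) (+ P) (ℤ.- + M) ⟨
    + g x ℤ.+ + P ℤ.- + M    ≡⟨ cong (ℤ._- + M) (ℤ.pos-+ (g x) P) ⟨
    + (g x + P) ℤ.- + M      ∎
    where
    open ≡-Reasoning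
    P M : ℕ
    P = sum (map g (positives xs))
    M = sum (map g (negatives xs))
  ... | .-1ℤ | inj₂ (inj₂ refl) = begin
    -1ℤ ℤ.* + g x ℤ.+ foldr (λ k s → w k ℤ.* + g k ℤ.+ s) 0ℤ xs
      ≡⟨ cong₂ ℤ._+_ (ℤ.-1*i≡-i (+ g x)) (signedSum-split g xs) ⟩
    ℤ.- + g x ℤ.+ (+ P ℤ.- + M)  ≡⟨ +-leftComm (ℤ.- + g x) (+ P) (ℤ.- + M) ⟩
    + P ℤ.+ (ℤ.- + g x ℤ.- + M)  ≡⟨ cong (ℤ._+_ (+ P)) (ℤ.neg-distrib-+ (+ g x) (+ M)) ⟨
    + P ℤ.- (+ g x ℤ.+ + M)      ≡⟨ cong (λ m → + P ℤ.- m) (ℤ.pos-+ (g x) M) ⟨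
    + P ℤ.- + (g x + M)          ∎
    where
    open ≡-Reasoning
    P M : ℕ
    P = sum (map g (positives xs))
    M = sum (map g (negatives xs))

μ⁺-divisors μ⁻-divisors : ℕ → List ℕ
μ⁺-divisors N = filter (λ k → μ (quot N k) ℤ.≟ 1ℤ) (divisors N)
μ⁻-divisors N = filter (λ k → μ (quot N k) ℤ.≟ -1ℤ) (divisors N)

ν₂≡μ⁺-μ⁻ : ∀ N → ν₂ N ≡ + sum (map (2 ^_) (μ⁺-divisors N)) ℤ.- + sum (map (2 ^_) (μ⁻-divisors N))
ν₂≡μ⁺-μ⁻ N = signedSum-split (μ ∘ quot N) (μ-values ∘ quot N) (2 ^_) (divisors N)

length-μ⁺≡length-μ⁻ : ∀ N → 1 < N → length (μ⁺-divisors N) ≡ length (μ⁻-divisors N)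
length-μ⁺≡length-μ⁻ N 1<N = ℤ.+-injective (ℤ.i-j≡0⇒i≡j _ _ (begin
  + length (μ⁺-divisors N) ℤ.- + length (μ⁻-divisors N)
    ≡⟨ cong₂ (λ m n → + m ℤ.- + n) (sum-map-const-1 (μ⁺-divisors N)) (sum-map-const-1 (μ⁻-divisors N)) ⟨
  + sum (map (λ _ → 1) (μ⁺-divisors N)) ℤ.- + sum (map (λ _ → 1) (μ⁻-divisors N))
    ≡⟨ signedSum-split (μ ∘ quot N) (μ-values ∘ quot N) (λ _ → 1) (divisors N) ⟨
  foldr (λ k s → μ (quot N k) ℤ.* 1ℤ ℤ.+ s) 0ℤ (divisors N)
    ≡⟨ foldr-divisors N (λ k → μ (quot N k) ℤ.* 1ℤ) ⟩
  divisorSum N (λ k → μ (quot N k) ℤ.* 1ℤ)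
    ≡⟨ Σ<-cong (suc N) (λ t _ →
         cong (λ x → if does (isDivisor? N t) then x else 0ℤ) (ℤ.*-identityʳ (μ (quot N t)))) ⟩
  divisorSum N (μ ∘ quot N)
    ≡⟨ divisorSum-μ≡0 N 1<N ⟩
  0ℤ ∎))
  where open ≡-Reasoning

μ±-divisors-positive : ∀ N {P : ℕ → Set} (P? : Decidable P) → All (1 ≤_) (filter P? (divisors N))
μ±-divisors-positive N P? = All.filter⁺ P? (All.map proj₁ (All.all-filter (isDivisor? N) (upTo (suc N))))

∣+m-+n∣≡m∸n : ∀ {m n} → n ≤ m → ∣ + m ℤ.- + n ∣ ≡ m ∸ n
∣+m-+n∣≡m∸n {m} {n} n≤m = cong ∣_∣ (trans (ℤ.m-n≡m⊖n m n) (ℤ.⊖-≥ n≤m))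

cyclotomic-quotient : ∀ v N C → IsCyclotomic v N C →
  constXY C ⊛₂ prod₂ (map (cycFactor v) (μ⁻-divisors N)) ≈₂ prod₂ (map (cycFactor v) (μ⁺-divisors N))
cyclotomic-quotient v N C C-quotient k l =
  trans (⊛₂-congˡ (constXY C) (λ k l → sym (constXY-prodE factor (μ⁻-divisors N) k l)) k l)
        (trans (C-quotient 0 0 k l) (constXY-prodE factor (μ⁺-divisors N) k l))
  where
  factor : ℕ → Expr
  factor d = var v :^ d :- con 1ℤ

Φ*-coeff-x^ν₂ : ∀ N → 1 < N → ∀ P → IsPhiStar N P → ∀ C → IsCyclotomic vb N C →
  ∀ k l → P ∣ ν₂ N ∣ 0 k l ≡ C 0 0 k l
Φ*-coeff-x^ν₂ N 1<N P P-quotient C C-quotient k l =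
  trans (cong (λ i → P i 0 k l) (trans (cong ∣_∣ (ν₂≡μ⁺-μ⁻ N)) (∣+m-+n∣≡m∸n D≤M))) (P≈C k l)
  where
  ns ds : List ℕ
  ns = μ⁺-divisors N
  ds = μ⁻-divisors N
  M D : ℕ
  M = sum (map (2 ^_) ns)
  D = sum (map (2 ^_) ds)
  factor : ℕ → Series₂
  factor = ⊖₂_ ∘ cycFactor vb
  |ns|≡|ds| : length ns ≡ length ds
  |ns|≡|ds| = length-μ⁺≡length-μ⁻ N 1<N
  numerator : LeadingY (length ds) M (prod₂ (map factor ns)) ⟦ mobNum Φ N ⟧
  numerator = subst (λ m → LeadingY m M (prod₂ (map factor ns)) ⟦ mobNum Φ N ⟧) |ns|≡|ds|
                    (LeadingY-prodE Φ Φ-leadingY ns)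
  nonZero : ∀ {xs} → All (1 ≤_) xs → ℤ.NonZero (prod₂ (map factor xs) 0 0)
  nonZero = prod₂-nonZero factor ∘ All.map (⊖₂-cycFactor-nonZero vb)
  leading : D ≤ M × (λ k l → P (M ∸ D) 0 k l) ⊛₂ prod₂ (map factor ds) ≈₂ prod₂ (map factor ns)
  leading = quotient-leadingY {P} P-quotient (LeadingY-prodE Φ Φ-leadingY ds) numerator
                              (nonZero (μ±-divisors-positive N _))
  D≤M : D ≤ M
  D≤M = proj₁ leading
  P≈C : (λ k l → P (M ∸ D) 0 k l) ≈₂ constXY C
  P≈C = ⊛₂-cancelʳ (prod₂ (map factor ds)) (nonZero (μ±-divisors-positive N _)) λ k l →
    trans (proj₂ leading k l) (sym (quotient-map-⊖₂ (constXY C) (cycFactor vb) ds ns (sym |ns|≡|ds|)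
                                                    (cyclotomic-quotient vb N C C-quotient) k l))

Φ*-coeff-y^ν₂ : ∀ N → 1 < N → ∀ P → IsPhiStar N P → ∀ C → IsCyclotomic va N C →
  ∀ k l → P 0 ∣ ν₂ N ∣ k l ≡ C 0 0 k l
Φ*-coeff-y^ν₂ N 1<N P P-quotient C C-quotient k l =
  trans (cong (λ j → P 0 j k l) (trans (cong ∣_∣ (ν₂≡μ⁺-μ⁻ N)) (∣+m-+n∣≡m∸n D≤M))) (P≈C k l)
  where
  ns ds : List ℕ
  ns = μ⁺-divisors N
  ds = μ⁻-divisors N
  M D : ℕ
  M = sum (map (2 ^_) ns)
  D = sum (map (2 ^_) ds)
  factor : ℕ → Series₂
  factor = cycFactor va
  numerator : LeadingX (length ds) M (prod₂ (map factor ns)) ⟦ mobNum Φ N ⟧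
  numerator = subst (λ m → LeadingX m M (prod₂ (map factor ns)) ⟦ mobNum Φ N ⟧) (length-μ⁺≡length-μ⁻ N 1<N)
                    (LeadingX-prodE Φ Φ-leadingX ns)
  nonZero : ∀ {xs} → All (1 ≤_) xs → ℤ.NonZero (prod₂ (map factor xs) 0 0)
  nonZero = prod₂-nonZero factor ∘ All.map (cycFactor-nonZero va)
  leading : D ≤ M × (λ k l → P 0 (M ∸ D) k l) ⊛₂ prod₂ (map factor ds) ≈₂ prod₂ (map factor ns)
  leading = quotient-leadingX {P} P-quotient (LeadingX-prodE Φ Φ-leadingX ds) numerator
                              (nonZero (μ±-divisors-positive N _))
  D≤M : D ≤ M
  D≤M = proj₁ leading
  P≈C : (λ k l → P 0 (M ∸ D) k l) ≈₂ constXY C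
  P≈C = ⊛₂-cancelʳ (prod₂ (map factor ds)) (nonZero (μ±-divisors-positive N _)) λ k l →
    trans (proj₂ leading k l) (sym (cyclotomic-quotient va N C C-quotient k l))

mainTheorem6 : (N : ℕ) → 1 < N →
    (P : Series) → IsPhiStar N P →
    (Ca Cb : Series) → IsCyclotomic va N Ca → IsCyclotomic vb N Cb →
    (∀ k l → P ∣ ν₂ N ∣ 0 k l ≡ Cb 0 0 k l) × (∀ k l → P 0 ∣ ν₂ N ∣ k l ≡ Ca 0 0 k l)
mainTheorem6 N 1<N P P-quotient Ca Cb Ca-quotient Cb-quotient =
  Φ*-coeff-x^ν₂ N 1<N P P-quotient Cb Cb-quotient , Φ*-coeff-y^ν₂ N 1<N P P-quotient Ca Ca-quotient
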